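{- For $n\ge 1$ let $P_n(x,z)=\sum_{\sigma\in S_n} x^{\mathrm{asc}(\sigma)} z^{\mathrm{suc}(\sigma)}$. Then $$\sum_{n\ge 0} P_{n+1}(x,z)\frac{t^n}{n!}=\frac{x(1-x)^2 e^{(xz+1)t}}{(e^{xt}-xe^{t})^2}.$$
   Context: $S_n$ is the set of permutations $\sigma=\sigma_1\cdots\sigma_n$ of $[n]=\{1,\dots,n\}$, and one sets $\sigma_0=0$. An ascent of $\sigma$ is an index $0\le i\le n-1$ with $\sigma_i<\sigma_{i+1}$ (so index $0$ is always an ascent); $\mathrm{asc}(\sigma)$ is the number of ascents. A (interior) succession is an index $1\le i\le n-1$ with $\sigma_i+1=\sigma_{i+1}$; $\mathrm{suc}(\sigma)$ is the number of successions. -}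

module Defs where

open import Data.Nat as ℕ using (ℕ; zero; suc)
open import Data.Bool using (Bool; true; false; _∧_; not; if_then_else_)
open import Data.List using (List; []; _∷_; map; concatMap; upTo; length)
open import Data.Integer as ℤ using (ℤ; +_; _+_; _*_; _-_; _^_)
open import Data.Nat.Combinatorics using (_C_)

words : ℕ → ℕ → List (List ℕ)
words n zero    = [] ∷ []
words n (suc k) = concatMap (λ a → map (a ∷_) (words n k)) (map suc (upTo n))

notIn : ℕ → List ℕ → Bool
notIn a []      = true
notIn a (b ∷ l) = not (a ℕ.≡ᵇ b) ∧ notIn a l

distinct : List ℕ → Bool
distinct []      = true
distinct (a ∷ l) = notIn a l ∧ distinct l

keep : (List ℕ → Bool) → List (List ℕ) → List (List ℕ)
keep p []      = []
keep p (w ∷ ws) = if p w then w ∷ keep p ws else keep p ws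

-- S_n : permutations σ₁⋯σₙ of [n] in one-line notation
-- (injective words of length n over [n]).
Sym : ℕ → List (List ℕ)
Sym n = keep distinct (words n n)

ascents : List ℕ → ℕ
ascents []            = 0
ascents (a ∷ [])      = 0
ascents (a ∷ b ∷ l)   = (if a ℕ.<ᵇ b then 1 else 0) ℕ.+ ascents (b ∷ l)

-- asc(σ): ascents of σ₀σ₁⋯σₙ with σ₀ = 0 (index 0 included)
asc : List ℕ → ℕ
asc σ = ascents (0 ∷ σ)

succs : List ℕ → ℕ
succs []          = 0
succs (a ∷ [])    = 0
succs (a ∷ b ∷ l) = (if suc a ℕ.≡ᵇ b then 1 else 0) ℕ.+ succs (b ∷ l)

sumℤ : List ℤ → ℤ
sumℤ []      = + 0
sumℤ (a ∷ l) = a + sumℤ l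

P : ℕ → ℤ → ℤ → ℤ
P n x z = sumℤ (map (λ σ → (x ^ asc σ) * (z ^ succs σ)) (Sym n))

-- n! [t^n] of (e^{xt} - x e^t)^2 = e^{2xt} - 2x e^{(x+1)t} + x^2 e^{2t}
D : ℤ → ℕ → ℤ
D x m = ((+ 2 * x) ^ m) - (+ 2 * x * ((x + + 1) ^ m)) + (x * x * ((+ 2) ^ m))

-- n! [t^n] of (Σ_k P_{k+1}(x,z) t^k/k!) · (e^{xt} - x e^t)^2  (binomial convolution)
lhsCoeff : ℤ → ℤ → ℕ → ℤ
lhsCoeff x z n = sumℤ (map (λ k → + (n C k) * P (suc k) x z * D x (n ℕ.∸ k)) (upTo (suc n)))

-- n! [t^n] of x(1-x)^2 e^{(xz+1)t}
rhsCoeff : ℤ → ℤ → ℕ → ℤ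
rhsCoeff x z n = x * ((+ 1 - x) ^ 2) * ((x * z + + 1) ^ n)

{-# OPTIONS --safe #-}
-- Give a permutation with p successions, q further ascents and r = n - asc non-ascents the weight
-- (u + c₁)^p u^q (u + c₂)^r in an auxiliary variable u, where c₁ = xz - x and c₂ = 1 - x, so that at
-- u = x it becomes x^asc z^suc. Inserting n + 1 into all gaps of a permutation of [n] acts on weights as
-- Y ↦ (u + c₁) Y + u (u + c₂) Y′, hence the EGFs G_m(t) of the u^m-coefficients satisfy
-- G_m′ = m G_(m-1) + (c₁ + m c₂) G_m with G_m(0) = [m = 1]. The solution is G_m = m e^((c₁+c₂)t) B^(m-1)
-- with B = (e^(c₂t) - 1)/c₂, so Σ_m x^m G_m = x e^((c₁+c₂)t) / (1 - xB)², while
-- c₂ e^(xt) (1 - xB) = e^(xt) - x e^t. The generating-function identities are proved coefficientwise,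
-- in the ring of integer sequences under binomial convolution.
module Submission where

open import Defs
open import Data.Nat as ℕ using (ℕ; zero; suc; pred; _∸_; _≤_; _<_; z≤n; s≤s; _<ᵇ_; _≡ᵇ_)
import Data.Nat.Properties as ℕP
open import Data.Nat.Combinatorics using (_C_; nCk+nC[k+1]≡[n+1]C[k+1]; nCk≡nC[n∸k]; nCn≡1; k>n⇒nCk≡0)
open import Data.Integer using (ℤ; 0ℤ; +_; _+_; _*_; _-_; -_; _^_)
import Data.Integer.Properties as ℤP
open import Data.Integer.Tactic.RingSolver using (solve-∀)
open import Data.Bool using (Bool; true; false; T; not; if_then_else_)
open import Data.Bool.Properties using (T-∧)
open import Data.Empty using (⊥-elim)
open import Data.Product using (_×_; _,_; proj₁; proj₂; ∃₂; uncurry)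
open import Data.List using (List; []; _∷_; _++_; length; map; concatMap; upTo; filterᵇ; cartesianProductWith; cartesianProduct)
import Data.List.Properties as Listₚ
open import Data.List.Relation.Unary.All as All using (All; []; _∷_)
import Data.List.Relation.Unary.All.Properties as Allₚ
open import Data.List.Relation.Unary.Any using (here; there)
open import Data.List.Relation.Unary.AllPairs using ([]; _∷_)
open import Data.List.Relation.Unary.Unique.Propositional using (Unique)
import Data.List.Relation.Unary.Unique.Propositional.Properties as Uniqueₚ
open import Data.List.Membership.Propositional using (_∈_)
open import Data.List.Membership.Propositional.Properties
  using (∈-map⁺; ∈-map⁻; ∈-upTo⁺; ∈-upTo⁻; ∈-filter⁺; ∈-filter⁻; ∈-∃++;
         ∈-cartesianProductWith⁺; ∈-cartesianProductWith⁻; ∈-cartesianProduct⁺; ∈-cartesianProduct⁻)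
open import Data.List.Membership.Propositional.Properties.WithK using (unique∧set⇒bag)
open import Data.List.Membership.DecPropositional ℕP._≟_ using (_∈?_)
open import Data.List.Relation.Binary.BagAndSetEquality using (∼bag⇒↭)
open import Data.List.Relation.Binary.Permutation.Propositional
  using (_↭_; refl; prep; swap; trans; ↭-refl; ↭-prep; ↭-swap; ↭-trans; ↭-sym; ↭⇒↭ₛ)
open import Data.List.Relation.Binary.Permutation.Propositional.Properties
  using (All-resp-↭; ↭-length) renaming (shift to ↭-shift)
open import Function using (_∘_; _⇔_; Equivalence)
open import Function.Bundles using (mk⇔)
open import Relation.Nullary using (yes; no)
open import Relation.Nullary.Decidable using (T?; dec-true; dec-false)
open import Relation.Binary.PropositionalEquality as ≡
  using (_≡_; _≢_; _≗_; cong; cong₂; sym; _→-setoid_; module ≡-Reasoning)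
open import Data.List.Relation.Binary.Permutation.Setoid.Properties (≡.setoid ℕ) using (Unique-resp-↭)
import Relation.Binary.Reasoning.Setoid as SetoidReasoning

∑ : ∀ {A : Set} → List A → (A → ℤ) → ℤ
∑ l f = sumℤ (map f l)

Σ< : ℕ → (ℕ → ℤ) → ℤ
Σ< n = ∑ (upTo n)

module _ {A : Set} where

  ∑-cong : ∀ (l : List A) {f g} → (∀ {a} → a ∈ l → f a ≡ g a) → ∑ l f ≡ ∑ l g
  ∑-cong []      f≡g = ≡.refl
  ∑-cong (a ∷ l) f≡g = cong₂ _+_ (f≡g (here ≡.refl)) (∑-cong l (f≡g ∘ there))

  ∑-zero : ∀ (l : List A) {f} → (∀ {a} → a ∈ l → f a ≡ + 0) → ∑ l f ≡ + 0
  ∑-zero []      f≡0 = ≡.refl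
  ∑-zero (a ∷ l) f≡0 = cong₂ _+_ (f≡0 (here ≡.refl)) (∑-zero l (f≡0 ∘ there))

  ∑-+ : ∀ (l : List A) f g → ∑ l (λ a → f a + g a) ≡ ∑ l f + ∑ l g
  ∑-+ []      f g = ≡.refl
  ∑-+ (a ∷ l) f g = ≡.trans (cong (_+_ (f a + g a)) (∑-+ l f g)) (interchange (f a) (g a) _ _)
    where interchange : ∀ a b c d → a + b + (c + d) ≡ a + c + (b + d)
          interchange = solve-∀

  ∑-*ˡ : ∀ (l : List A) c f → ∑ l (λ a → c * f a) ≡ c * ∑ l f
  ∑-*ˡ []      c f = sym (ℤP.*-zeroʳ c)
  ∑-*ˡ (a ∷ l) c f = ≡.trans (cong (_+_ (c * f a)) (∑-*ˡ l c f)) (sym (ℤP.*-distribˡ-+ c (f a) _))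

  ∑-*ʳ : ∀ (l : List A) c f → ∑ l (λ a → f a * c) ≡ ∑ l f * c
  ∑-*ʳ l c f = ≡.trans (∑-cong l (λ {a} _ → ℤP.*-comm (f a) c)) (≡.trans (∑-*ˡ l c f) (ℤP.*-comm c _))

  ∑-++ : ∀ (xs ys : List A) (f : A → ℤ) → ∑ (xs ++ ys) f ≡ ∑ xs f + ∑ ys f
  ∑-++ []       ys f = sym (ℤP.+-identityˡ _)
  ∑-++ (a ∷ xs) ys f = ≡.trans (cong (_+_ (f a)) (∑-++ xs ys f)) (sym (ℤP.+-assoc (f a) _ _))

  ∑-↭ : ∀ {xs ys : List A} f → xs ↭ ys → ∑ xs f ≡ ∑ ys f
  ∑-↭ f refl          = ≡.refl
  ∑-↭ f (prep a p)    = cong (_+_ (f a)) (∑-↭ f p)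
  ∑-↭ f (swap a b p)  = ≡.trans (cong (λ s → f a + (f b + s)) (∑-↭ f p)) (swap-front (f a) (f b) _)
    where swap-front : ∀ a b c → a + (b + c) ≡ b + (a + c)
          swap-front = solve-∀
  ∑-↭ f (trans p q)   = ≡.trans (∑-↭ f p) (∑-↭ f q)

module _ {A B : Set} where

  ∑-swap : ∀ (xs : List A) (ys : List B) (F : A → B → ℤ) →
           ∑ xs (λ a → ∑ ys (F a)) ≡ ∑ ys (λ b → ∑ xs (λ a → F a b))
  ∑-swap []       ys F = sym (∑-zero ys (λ _ → ≡.refl))
  ∑-swap (a ∷ xs) ys F = ≡.trans (cong (_+_ (∑ ys (F a))) (∑-swap xs ys F)) (sym (∑-+ ys (F a) _))

  ∑-cartesianProduct : ∀ (xs : List A) (ys : List B) (F : A → B → ℤ) →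
                       ∑ (cartesianProduct xs ys) (uncurry F) ≡ ∑ xs (λ a → ∑ ys (F a))
  ∑-cartesianProduct []       ys F = ≡.refl
  ∑-cartesianProduct (a ∷ xs) ys F = begin
    ∑ (map (a ,_) ys ++ cartesianProduct xs ys) (uncurry F)
      ≡⟨ ∑-++ (map (a ,_) ys) _ (uncurry F) ⟩
    ∑ (map (a ,_) ys) (uncurry F) + ∑ (cartesianProduct xs ys) (uncurry F)
      ≡⟨ cong₂ _+_ (cong sumℤ (sym (Listₚ.map-∘ ys))) (∑-cartesianProduct xs ys F) ⟩
    ∑ ys (F a) + ∑ xs (λ a → ∑ ys (F a)) ∎
    where open ≡-Reasoning

Σ<-suc : ∀ n f → Σ< (suc n) f ≡ f 0 + Σ< n (f ∘ suc)
Σ<-suc n f = cong (λ l → f 0 + sumℤ l)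
  (≡.trans (Listₚ.map-applyUpTo suc f n) (sym (Listₚ.map-upTo (f ∘ suc) n)))

Σ<-last : ∀ n f → Σ< (suc n) f ≡ Σ< n f + f n
Σ<-last n f = begin
  Σ< (suc n) f               ≡⟨ cong (λ l → ∑ l f) (sym (Listₚ.upTo-∷ʳ n)) ⟩
  ∑ (upTo n ++ n ∷ []) f     ≡⟨ ∑-++ (upTo n) _ f ⟩
  Σ< n f + (f n + + 0)       ≡⟨ cong (_+_ (Σ< n f)) (ℤP.+-identityʳ (f n)) ⟩
  Σ< n f + f n               ∎
  where open ≡-Reasoning

Σ<-cong : ∀ n {f g} → (∀ {k} → k < n → f k ≡ g k) → Σ< n f ≡ Σ< n g
Σ<-cong n f≡g = ∑-cong (upTo n) (f≡g ∘ ∈-upTo⁻)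

Σ<-pad : ∀ n m f → (∀ {k} → n ≤ k → f k ≡ + 0) → Σ< (n ℕ.+ m) f ≡ Σ< n f
Σ<-pad zero    m f f≡0 = ∑-zero (upTo m) (λ _ → f≡0 z≤n)
Σ<-pad (suc n) m f f≡0 = begin
  Σ< (suc (n ℕ.+ m)) f          ≡⟨ Σ<-suc (n ℕ.+ m) f ⟩
  f 0 + Σ< (n ℕ.+ m) (f ∘ suc)  ≡⟨ cong (_+_ (f 0)) (Σ<-pad n m (f ∘ suc) (f≡0 ∘ s≤s)) ⟩
  f 0 + Σ< n (f ∘ suc)          ≡⟨ sym (Σ<-suc n f) ⟩
  Σ< (suc n) f                  ∎
  where open ≡-Reasoning

Σ<-telescope : ∀ n (t : ℕ → ℤ) → Σ< n (λ k → t k - t (suc k)) ≡ t 0 - t n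
Σ<-telescope zero    t = sym (ℤP.+-inverseʳ (t 0))
Σ<-telescope (suc n) t = begin
  Σ< (suc n) (λ k → t k - t (suc k))            ≡⟨ Σ<-suc n (λ k → t k - t (suc k)) ⟩
  t 0 - t 1 + Σ< n (λ k → t (suc k) - t (suc (suc k)))
                                                ≡⟨ cong (_+_ (t 0 - t 1)) (Σ<-telescope n (t ∘ suc)) ⟩
  t 0 - t 1 + (t 1 - t (suc n))                 ≡⟨ cancel (t 0) (t 1) (t (suc n)) ⟩
  t 0 - t (suc n)                               ∎
  where
  open ≡-Reasoning
  cancel : ∀ a b c → a - b + (b - c) ≡ a - c
  cancel = solve-∀

Σ<-weighted-telescope : ∀ n (b : ℕ → ℤ) → Σ< n (λ k → + suc k * (b k - b (suc k))) ≡ Σ< n b - + n * b n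
Σ<-weighted-telescope n b = begin
  Σ< n (λ k → + suc k * (b k - b (suc k)))  ≡⟨ Σ<-cong n (λ {k} _ → expand (+ k) (b k) (b (suc k))) ⟩
  Σ< n (λ k → b k + (t k - t (suc k)))      ≡⟨ ∑-+ (upTo n) b (λ k → t k - t (suc k)) ⟩
  Σ< n b + Σ< n (λ k → t k - t (suc k))     ≡⟨ cong (_+_ (Σ< n b)) (Σ<-telescope n t) ⟩
  Σ< n b + (+ 0 * b 0 - + n * b n)          ≡⟨ drop-zero (Σ< n b) (b 0) (+ n * b n) ⟩
  Σ< n b - + n * b n                        ∎
  where
  open ≡-Reasoning
  t : ℕ → ℤ
  t k = + k * b k
  expand : ∀ k u v → (+ 1 + k) * (u - v) ≡ u + (k * u - (+ 1 + k) * v)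
  expand = solve-∀
  drop-zero : ∀ s u w → s + (+ 0 * u - w) ≡ s - w
  drop-zero = solve-∀

-- Permutations as insertions of the maximum

Letter : ℕ → ℕ → Set
Letter n a = 1 ≤ a × a ≤ n

record IsPerm (n : ℕ) (w : List ℕ) : Set where
  field
    length≡ : length w ≡ n
    letters : All (Letter n) w
    unique  : Unique w

T-not-≡ᵇ : ∀ a b → T (not (a ≡ᵇ b)) ⇔ a ≢ b
T-not-≡ᵇ a b with a ≡ᵇ b in eq
... | true  = mk⇔ (λ ()) (λ a≢b → a≢b (ℕP.≡ᵇ⇒≡ a b (≡.subst T (sym eq) _)))
... | false = mk⇔ (λ _ a≡b → ≡.subst T eq (ℕP.≡⇒≡ᵇ a b a≡b)) (λ _ → _)

T-notIn : ∀ a l → T (notIn a l) ⇔ All (a ≢_) l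
T-notIn a []      = mk⇔ (λ _ → []) (λ _ → _)
T-notIn a (b ∷ l) = mk⇔
  (λ t → let a≢b , a∉l = Equivalence.to T-∧ t in Equivalence.to (T-not-≡ᵇ a b) a≢b ∷ Equivalence.to (T-notIn a l) a∉l)
  (λ { (a≢b ∷ a∉l) → Equivalence.from T-∧ (Equivalence.from (T-not-≡ᵇ a b) a≢b , Equivalence.from (T-notIn a l) a∉l) })

T-distinct : ∀ w → T (distinct w) ⇔ Unique w
T-distinct []      = mk⇔ (λ _ → []) (λ _ → _)
T-distinct (a ∷ w) = mk⇔
  (λ t → let a∉w , uw = Equivalence.to T-∧ t in Equivalence.to (T-notIn a w) a∉w ∷ Equivalence.to (T-distinct w) uw)
  (λ { (a∉w ∷ uw) → Equivalence.from T-∧ (Equivalence.from (T-notIn a w) a∉w , Equivalence.from (T-distinct w) uw) })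

keep≡filterᵇ : ∀ p (ws : List (List ℕ)) → keep p ws ≡ filterᵇ p ws
keep≡filterᵇ p []       = ≡.refl
keep≡filterᵇ p (w ∷ ws) with p w
... | true  = cong (w ∷_) (keep≡filterᵇ p ws)
... | false = keep≡filterᵇ p ws

words-suc : ∀ n k → words n (suc k) ≡ cartesianProductWith _∷_ (map suc (upTo n)) (words n k)
words-suc n k = go (map suc (upTo n))
  where go : ∀ as → concatMap (λ a → map (a ∷_) (words n k)) as ≡ cartesianProductWith _∷_ as (words n k)
        go []       = ≡.refl
        go (a ∷ as) = cong (map (a ∷_) (words n k) ++_) (go as)

letter⁺ : ∀ {n a} → Letter n a → a ∈ map suc (upTo n)
letter⁺ {a = suc a} (_ , a<n) = ∈-map⁺ suc (∈-upTo⁺ a<n)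

letter⁻ : ∀ {n a} → a ∈ map suc (upTo n) → Letter n a
letter⁻ a∈ with ∈-map⁻ suc a∈
... | _ , i∈ , ≡.refl = s≤s z≤n , ∈-upTo⁻ i∈

∈-words⁺ : ∀ n k {w} → length w ≡ k → All (Letter n) w → w ∈ words n k
∈-words⁺ n zero    {[]}    ≡.refl []        = here ≡.refl
∈-words⁺ n (suc k) {a ∷ w} ≡.refl (la ∷ lw) = ≡.subst (a ∷ w ∈_) (sym (words-suc n k))
  (∈-cartesianProductWith⁺ _∷_ (letter⁺ la) (∈-words⁺ n k ≡.refl lw))

∈-words⁻ : ∀ n k {w} → w ∈ words n k → length w ≡ k × All (Letter n) w
∈-words⁻ n zero    (here ≡.refl) = ≡.refl , []
∈-words⁻ n (suc k) w∈
  with _ , v , a∈ , v∈ , ≡.refl ← ∈-cartesianProductWith⁻ _∷_ (map suc (upTo n)) (words n k)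
                                     (≡.subst (_ ∈_) (words-suc n k) w∈)
  = let len , lv = ∈-words⁻ n k v∈ in cong suc len , letter⁻ a∈ ∷ lv

words-unique : ∀ n k → Unique (words n k)
words-unique n zero    = [] ∷ []
words-unique n (suc k) = ≡.subst Unique (sym (words-suc n k))
  (Uniqueₚ.cartesianProductWith⁺ _∷_ Listₚ.∷-injective
    (Uniqueₚ.map⁺ ℕP.suc-injective (Uniqueₚ.upTo⁺ n)) (words-unique n k))

Sym≡filterᵇ : ∀ n → Sym n ≡ filterᵇ distinct (words n n)
Sym≡filterᵇ n = keep≡filterᵇ distinct (words n n)

Sym-unique : ∀ n → Unique (Sym n)
Sym-unique n = ≡.subst Unique (sym (Sym≡filterᵇ n)) (Uniqueₚ.filter⁺ _ (words-unique n n))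

∈-Sym⇔IsPerm : ∀ n w → w ∈ Sym n ⇔ IsPerm n w
∈-Sym⇔IsPerm n w = mk⇔ from-Sym to-Sym
  where
  from-Sym : w ∈ Sym n → IsPerm n w
  from-Sym w∈ with w∈words , t ← ∈-filter⁻ (T? ∘ distinct) (≡.subst (w ∈_) (Sym≡filterᵇ n) w∈)
    = let len , ls = ∈-words⁻ n n w∈words
      in record { length≡ = len ; letters = ls ; unique = Equivalence.to (T-distinct w) t }
  to-Sym : IsPerm n w → w ∈ Sym n
  to-Sym p = ≡.subst (w ∈_) (sym (Sym≡filterᵇ n))
    (∈-filter⁺ (T? ∘ distinct) (∈-words⁺ n n (IsPerm.length≡ p) (IsPerm.letters p))
                               (Equivalence.from (T-distinct w) (IsPerm.unique p)))

ins : ℕ → ℕ → List ℕ → List ℕ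
ins zero    a l       = a ∷ l
ins (suc i) a []      = a ∷ []
ins (suc i) a (b ∷ l) = b ∷ ins i a l

ins-↭ : ∀ i a l → ins i a l ↭ a ∷ l
ins-↭ zero    a l       = ↭-refl
ins-↭ (suc i) a []      = ↭-refl
ins-↭ (suc i) a (b ∷ l) = ↭-trans (↭-prep b (ins-↭ i a l)) (↭-swap b a ↭-refl)

ins-++ : ∀ a ys zs → ins (length ys) a (ys ++ zs) ≡ ys ++ a ∷ zs
ins-++ a []       zs = ≡.refl
ins-++ a (y ∷ ys) zs = cong (y ∷_) (ins-++ a ys zs)

ins-injective : ∀ {a} i j σ τ → All (a ≢_) σ → All (a ≢_) τ → i ≤ length σ → j ≤ length τ →
                ins i a σ ≡ ins j a τ → i ≡ j × σ ≡ τ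
ins-injective zero    zero    σ       τ       _            _            _         _         ≡.refl = ≡.refl , ≡.refl
ins-injective zero    (suc j) σ       (c ∷ τ) _            (a≢c ∷ _)    _         _         ≡.refl = ⊥-elim (a≢c ≡.refl)
ins-injective (suc i) zero    (b ∷ σ) τ       (a≢b ∷ _)    _            _         _         ≡.refl = ⊥-elim (a≢b ≡.refl)
ins-injective (suc i) (suc j) (b ∷ σ) (c ∷ τ) (_ ∷ a∉σ)    (_ ∷ a∉τ)    (s≤s i≤)  (s≤s j≤)  eq
  with ≡.refl , eq′ ← Listₚ.∷-injective eq
  with ≡.refl , ≡.refl ← ins-injective i j σ τ a∉σ a∉τ i≤ j≤ eq′ = ≡.refl , ≡.refl

max∉ : ∀ {n σ} → All (Letter n) σ → All (suc n ≢_) σ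
max∉ = All.map λ { (_ , a≤n) ≡.refl → ℕP.1+n≰n a≤n }

shrink : ∀ {m w} → All (Letter (suc m)) w → All (suc m ≢_) w → All (Letter m) w
shrink []                  []          = []
shrink ((1≤a , a≤1+m) ∷ ls) (a≢ ∷ a≢s) = (1≤a , ℕP.≤-pred (ℕP.≤∧≢⇒< a≤1+m (a≢ ∘ sym))) ∷ shrink ls a≢s

IsPerm-ins : ∀ {n σ} i → IsPerm n σ → IsPerm (suc n) (ins i (suc n) σ)
IsPerm-ins {n} {σ} i p = record
  { length≡ = ≡.trans (↭-length (ins-↭ i (suc n) σ)) (cong suc (IsPerm.length≡ p))
  ; letters = All-resp-↭ (↭-sym (ins-↭ i (suc n) σ))
                ((s≤s z≤n , ℕP.≤-refl) ∷ All.map (λ (1≤a , a≤n) → 1≤a , ℕP.m≤n⇒m≤1+n a≤n) (IsPerm.letters p))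
  ; unique  = Unique-resp-↭ (↭⇒↭ₛ (↭-sym (ins-↭ i (suc n) σ))) (max∉ (IsPerm.letters p) ∷ IsPerm.unique p)
  }

remove-max : ∀ {m} ys zs → Unique (ys ++ suc m ∷ zs) → All (Letter (suc m)) (ys ++ suc m ∷ zs) →
             Unique (ys ++ zs) × All (Letter m) (ys ++ zs)
remove-max {m} ys zs u ls
  with m+1∉ ∷ u′ ← Unique-resp-↭ (↭⇒↭ₛ (↭-shift (suc m) ys zs)) u
  with _ ∷ ls′ ← All-resp-↭ (↭-shift (suc m) ys zs) ls
  = u′ , shrink ls′ m+1∉

unique⇒length≤ : ∀ m {w} → Unique w → All (Letter m) w → length w ≤ m
unique⇒length≤ zero    {[]}    _ _                     = z≤n
unique⇒length≤ zero    {a ∷ w} _ ((1≤a , a≤0) ∷ _)     = ⊥-elim (ℕP.<⇒≱ 1≤a a≤0)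
unique⇒length≤ (suc m) {w}     u ls with suc m ∈? w
... | no  m+1∉w = ℕP.m≤n⇒m≤1+n (unique⇒length≤ m u (shrink ls (Allₚ.¬Any⇒All¬ w m+1∉w)))
... | yes m+1∈w with ys , zs , ≡.refl ← ∈-∃++ m+1∈w =
  let u′ , ls′ = remove-max ys zs u ls in
  ℕP.≤-trans (ℕP.≤-reflexive (↭-length (↭-shift (suc m) ys zs))) (s≤s (unique⇒length≤ m u′ ls′))

IsPerm-max∈ : ∀ {n w} → IsPerm (suc n) w → suc n ∈ w
IsPerm-max∈ {n} {w} p with suc n ∈? w
... | yes n+1∈w = n+1∈w
... | no  n+1∉w = ⊥-elim (ℕP.1+n≰n (≡.subst (_≤ n) (IsPerm.length≡ p)
                    (unique⇒length≤ n (IsPerm.unique p) (shrink (IsPerm.letters p) (Allₚ.¬Any⇒All¬ w n+1∉w)))))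

IsPerm-split : ∀ {n w} → IsPerm (suc n) w → ∃₂ λ σ i → IsPerm n σ × i ≤ n × ins i (suc n) σ ≡ w
IsPerm-split {n} p with ys , zs , ≡.refl ← ∈-∃++ (IsPerm-max∈ p) =
  let u′ , ls′ = remove-max ys zs (IsPerm.unique p) (IsPerm.letters p)
      len = ℕP.suc-injective (≡.trans (sym (↭-length (↭-shift (suc n) ys zs))) (IsPerm.length≡ p))
  in ys ++ zs , length ys , record { length≡ = len ; letters = ls′ ; unique = u′ } ,
     ≡.subst (length ys ≤_) len (Listₚ.length-++-≤ˡ ys) , ins-++ (suc n) ys zs

module _ {A B : Set} where

  map⁺-injectiveOn : ∀ (f : A → B) {xs} → (∀ {x y} → x ∈ xs → y ∈ xs → f x ≡ f y → x ≡ y) →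
                     Unique xs → Unique (map f xs)
  map⁺-injectiveOn f {[]}     _   []           = []
  map⁺-injectiveOn f {x ∷ xs} inj (x∉xs ∷ u) =
    Allₚ.map⁺ (All.tabulate λ {y} y∈xs fx≡fy → All.lookup x∉xs y∈xs (inj (here ≡.refl) (there y∈xs) fx≡fy))
    ∷ map⁺-injectiveOn f (λ p q → inj (there p) (there q)) u

insertions : ℕ → List (List ℕ)
insertions n = map (uncurry λ σ i → ins i (suc n) σ) (cartesianProduct (Sym n) (upTo (suc n)))

Sym-suc↭insertions : ∀ n → Sym (suc n) ↭ insertions n
Sym-suc↭insertions n = ∼bag⇒↭ (unique∧set⇒bag (Sym-unique (suc n)) insertions-unique (mk⇔ to from))
  where
  M = suc n
  insert = uncurry λ σ i → ins i M σ
  pairs = cartesianProduct (Sym n) (upTo (suc n))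
  valid : ∀ {σ i} → (σ , i) ∈ pairs → IsPerm n σ × i ≤ n
  valid p∈ with σ∈ , i∈ ← ∈-cartesianProduct⁻ (Sym n) (upTo (suc n)) p∈ =
    Equivalence.to (∈-Sym⇔IsPerm n _) σ∈ , ℕP.≤-pred (∈-upTo⁻ i∈)
  insertions-unique : Unique (insertions n)
  insertions-unique = map⁺-injectiveOn insert inj (Uniqueₚ.cartesianProduct⁺ (Sym-unique n) (Uniqueₚ.upTo⁺ (suc n)))
    where
    inj : ∀ {x y} → x ∈ pairs → y ∈ pairs → insert x ≡ insert y → x ≡ y
    inj {σ , i} {τ , j} x∈ y∈ eq
      with pσ , i≤n ← valid x∈ | pτ , j≤n ← valid y∈
      with ≡.refl , ≡.refl ← ins-injective i j σ τ (max∉ (IsPerm.letters pσ)) (max∉ (IsPerm.letters pτ))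
             (≡.subst (i ≤_) (sym (IsPerm.length≡ pσ)) i≤n) (≡.subst (j ≤_) (sym (IsPerm.length≡ pτ)) j≤n) eq
      = ≡.refl
  to : ∀ {w} → w ∈ Sym M → w ∈ insertions n
  to {w} w∈ with σ , i , pσ , i≤n , ≡.refl ← IsPerm-split (Equivalence.to (∈-Sym⇔IsPerm M w) w∈) =
    ∈-map⁺ insert (∈-cartesianProduct⁺ (Equivalence.from (∈-Sym⇔IsPerm n σ) pσ) (∈-upTo⁺ (s≤s i≤n)))
  from : ∀ {w} → w ∈ insertions n → w ∈ Sym M
  from w∈ with (σ , i) , p∈ , ≡.refl ← ∈-map⁻ insert w∈ =
    Equivalence.from (∈-Sym⇔IsPerm M _) (IsPerm-ins i (proj₁ (valid p∈)))

∑-Sym-suc : ∀ n f → ∑ (Sym (suc n)) f ≡ ∑ (Sym n) (λ σ → Σ< (suc n) (λ i → f (ins i (suc n) σ)))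
∑-Sym-suc n f = begin
  ∑ (Sym (suc n)) f                                ≡⟨ ∑-↭ f (Sym-suc↭insertions n) ⟩
  ∑ (insertions n) f                               ≡⟨ cong sumℤ (sym (Listₚ.map-∘ pairs)) ⟩
  ∑ pairs (uncurry λ σ i → f (ins i (suc n) σ))    ≡⟨ ∑-cartesianProduct (Sym n) (upTo (suc n)) (λ σ i → f (ins i (suc n) σ)) ⟩
  ∑ (Sym n) (λ σ → Σ< (suc n) (λ i → f (ins i (suc n) σ))) ∎
  where
  open ≡-Reasoning
  pairs = cartesianProduct (Sym n) (upTo (suc n))

-- Ascents and successions under insertion of the maximum

*-pred-cong : ∀ k {a b} → (∀ {j} → k ≡ suc j → a ≡ b) → + k * a ≡ + k * b
*-pred-cong zero    {a} {b} _   = ≡.trans (ℤP.*-zeroˡ a) (sym (ℤP.*-zeroˡ b))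
*-pred-cong (suc j)         a≡b = cong (+ suc j *_) (a≡b ≡.refl)

pos-∸ : ∀ {a s} → s ≤ a → + a - + s ≡ + (a ∸ s)
pos-∸ {a} {s} s≤a = ≡.trans (ℤP.m-n≡m⊖n a s) (ℤP.⊖-≥ s≤a)

-- Written like the summands of ascents and succs in Defs, so that those unfold to 𝕀 (a <ᵇ b) and 𝕀 (suc a ≡ᵇ b).
𝕀 : Bool → ℕ
𝕀 b = if b then 1 else 0

𝕀-< : ∀ {m n} → m < n → 𝕀 (m <ᵇ n) ≡ 1
𝕀-< m<n = cong 𝕀 (dec-true (_ ℕP.<? _) m<n)

𝕀-≥ : ∀ {m n} → n ≤ m → 𝕀 (m <ᵇ n) ≡ 0
𝕀-≥ n≤m = cong 𝕀 (dec-false (_ ℕP.<? _) (ℕP.≤⇒≯ n≤m))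

𝕀-≡ : ∀ {m n} → m ≡ n → 𝕀 (m ≡ᵇ n) ≡ 1
𝕀-≡ m≡n = cong 𝕀 (dec-true (_ ℕP.≟ _) m≡n)

𝕀-≢ : ∀ {m n} → m ≢ n → 𝕀 (m ≡ᵇ n) ≡ 0
𝕀-≢ m≢n = cong 𝕀 (dec-false (_ ℕP.≟ _) m≢n)

occurrences : ℕ → List ℕ → ℕ
occurrences a []      = 0
occurrences a (b ∷ l) = 𝕀 (b ≡ᵇ a) ℕ.+ occurrences a l

occurrences-∉ : ∀ {a} l → All (a ≢_) l → occurrences a l ≡ 0
occurrences-∉ []      []         = ≡.refl
occurrences-∉ (b ∷ l) (a≢b ∷ a∉) = cong₂ ℕ._+_ (𝕀-≢ (a≢b ∘ sym)) (occurrences-∉ l a∉)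

occurrences-unique : ∀ {a l} → a ∈ l → Unique l → occurrences a l ≡ 1
occurrences-unique {a} {b ∷ l} (here ≡.refl) (a∉ ∷ _) = cong₂ ℕ._+_ (𝕀-≡ {a} ≡.refl) (occurrences-∉ l a∉)
occurrences-unique {a} {b ∷ l} (there a∈l)   (b∉ ∷ u) =
  cong₂ ℕ._+_ (𝕀-≢ {b} {a} λ { ≡.refl → All.lookup b∉ a∈l ≡.refl }) (occurrences-unique a∈l u)

shift : ℕ → ℕ → (ℕ → ℕ → ℤ) → ℕ → ℕ → ℤ
shift u v h a s = h (u ℕ.+ a) (v ℕ.+ s)

-- Total h-weight of (ascents, successions) of the words obtained by inserting a new maximum into the
-- L + 1 gaps after the first letter of a word with A ascents, S successions and k occurrences of the
-- old maximum: right after an old maximum it adds an ascent and a succession, inside a succession it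
-- removes that succession, inside another ascent it changes nothing, and elsewhere it adds an ascent.
spread : (ℕ → ℕ → ℤ) → ℕ → ℕ → ℕ → ℕ → ℤ
spread h A S k L = + k * h (suc A) (suc S) + + S * h A (pred S) + (+ A - + S) * h A S + (+ suc L - + A - + k) * h (suc A) S

data GapKind : ℕ → ℕ → ℕ → Set where
  afterMax   : GapKind 1 0 0
  succession : GapKind 0 1 1
  ascent     : GapKind 0 1 0
  descent    : GapKind 0 0 0

retype : ∀ {e u v e′ u′ v′} → e ≡ e′ → u ≡ u′ → v ≡ v′ → GapKind e′ u′ v′ → GapKind e u v
retype ≡.refl ≡.refl ≡.refl kind = kind

module _ (n : ℕ) where

  gapKind : ∀ {b c} → b ≤ n → c ≤ n → GapKind (𝕀 (b ≡ᵇ n)) (𝕀 (b <ᵇ c)) (𝕀 (suc b ≡ᵇ c))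
  gapKind {b} {c} b≤n c≤n with b ℕP.≟ n | b ℕP.<? c | suc b ℕP.≟ c
  ... | yes ≡.refl | _       | _         =
    retype (𝕀-≡ {n} ≡.refl) (𝕀-≥ {n} c≤n) (𝕀-≢ {suc n} {c} λ { ≡.refl → ℕP.1+n≰n c≤n }) afterMax
  ... | no b≢n     | yes b<c | yes 1+b≡c = retype (𝕀-≢ {b} b≢n) (𝕀-< {b} b<c) (𝕀-≡ {suc b} 1+b≡c) succession
  ... | no b≢n     | yes b<c | no 1+b≢c  = retype (𝕀-≢ {b} b≢n) (𝕀-< {b} b<c) (𝕀-≢ {suc b} 1+b≢c) ascent
  ... | no b≢n     | no b≮c  | _         =
    retype (𝕀-≢ {b} b≢n) (𝕀-≥ {b} (ℕP.≮⇒≥ b≮c)) (𝕀-≢ {suc b} {c} λ { ≡.refl → b≮c (ℕP.n<1+n b) })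
           descent

  endKind : ∀ {b} → b ≤ n → GapKind (𝕀 (b ≡ᵇ n)) 0 0
  endKind {b} b≤n with b ℕP.≟ n
  ... | yes ≡.refl = retype (𝕀-≡ {n} ≡.refl) ≡.refl ≡.refl afterMax
  ... | no b≢n     = retype (𝕀-≢ {b} b≢n) ≡.refl ≡.refl descent

spread-gap : ∀ {e u v} → GapKind e u v → ∀ h A S k L →
             h (suc A) (e ℕ.+ S) + spread (shift u v h) A S k L ≡ spread h (u ℕ.+ A) (v ℕ.+ S) (e ℕ.+ k) (suc L)
spread-gap afterMax   h A S k L = regroup (+ A) (+ S) (+ k) (+ L) (h (suc A) (suc S)) (h A (pred S)) (h A S) (h (suc A) S)
  where regroup : ∀ A S k L x₁ x₂ x₃ x₄ → x₁ + (k * x₁ + S * x₂ + (A - S) * x₃ + (+ 1 + L - A - k) * x₄)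
                                          ≡ (+ 1 + k) * x₁ + S * x₂ + (A - S) * x₃ + (+ 1 + (+ 1 + L) - A - (+ 1 + k)) * x₄
        regroup = solve-∀
spread-gap succession h A S k L = begin
  h (suc A) S + spread (shift 1 1 h) A S k L
    ≡⟨ cong (λ t → h (suc A) S + (+ k * h (suc (suc A)) (suc (suc S)) + t + (+ A - + S) * h (suc A) (suc S)
                                  + (+ suc L - + A - + k) * h (suc (suc A)) (suc S)))
            (*-pred-cong S λ { ≡.refl → ≡.refl }) ⟩
  h (suc A) S + (+ k * x₁ + + S * x₂ + (+ A - + S) * x₃ + (+ suc L - + A - + k) * x₄)
    ≡⟨ regroup (+ A) (+ S) (+ k) (+ L) x₁ x₂ x₃ x₄ ⟩
  spread h (suc A) (suc S) k (suc L) ∎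
  where
  open ≡-Reasoning
  x₁ = h (suc (suc A)) (suc (suc S))
  x₂ = h (suc A) S
  x₃ = h (suc A) (suc S)
  x₄ = h (suc (suc A)) (suc S)
  regroup : ∀ A S k L x₁ x₂ x₃ x₄ → x₂ + (k * x₁ + S * x₂ + (A - S) * x₃ + (+ 1 + L - A - k) * x₄)
                                   ≡ k * x₁ + (+ 1 + S) * x₂ + (+ 1 + A - (+ 1 + S)) * x₃ + (+ 1 + (+ 1 + L) - (+ 1 + A) - k) * x₄
  regroup = solve-∀
spread-gap ascent     h A S k L =
  regroup (+ A) (+ S) (+ k) (+ L) (h (suc (suc A)) (suc S)) (h (suc A) (pred S)) (h (suc A) S) (h (suc (suc A)) S)
  where regroup : ∀ A S k L x₁ x₂ x₃ x₄ → x₃ + (k * x₁ + S * x₂ + (A - S) * x₃ + (+ 1 + L - A - k) * x₄)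
                                          ≡ k * x₁ + S * x₂ + (+ 1 + A - S) * x₃ + (+ 1 + (+ 1 + L) - (+ 1 + A) - k) * x₄
        regroup = solve-∀
spread-gap descent    h A S k L = regroup (+ A) (+ S) (+ k) (+ L) (h (suc A) (suc S)) (h A (pred S)) (h A S) (h (suc A) S)
  where regroup : ∀ A S k L x₁ x₂ x₃ x₄ → x₄ + (k * x₁ + S * x₂ + (A - S) * x₃ + (+ 1 + L - A - k) * x₄)
                                          ≡ k * x₁ + S * x₂ + (A - S) * x₃ + (+ 1 + (+ 1 + L) - A - k) * x₄
        regroup = solve-∀

spread-end : ∀ {e} → GapKind e 0 0 → ∀ h → h 1 (e ℕ.+ 0) + + 0 ≡ spread h 0 0 (e ℕ.+ 0) 0
spread-end afterMax h = at-end (h 1 1) (h 0 0) (h 1 0)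
  where at-end : ∀ x₁ x₃ x₄ → x₁ + + 0 ≡ + 1 * x₁ + + 0 * x₃ + (+ 0 - + 0) * x₃ + (+ 1 - + 0 - + 1) * x₄
        at-end = solve-∀
spread-end descent  h = at-end (h 1 1) (h 0 0) (h 1 0)
  where at-end : ∀ x₁ x₃ x₄ → x₄ + + 0 ≡ + 0 * x₁ + + 0 * x₃ + (+ 0 - + 0) * x₃ + (+ 1 - + 0 - + 0) * x₄
        at-end = solve-∀

module _ (n : ℕ) where

  private M = suc n

  insertionSum : (ℕ → ℕ → ℤ) → ℕ → List ℕ → ℤ
  insertionSum h b l = Σ< (suc (length l)) (λ j → h (ascents (b ∷ ins j M l)) (succs (b ∷ ins j M l)))

  insertionSum-∷ : ∀ h {b c} l → b ≤ n → c ≤ n →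
    insertionSum h b (c ∷ l) ≡ h (suc (ascents (c ∷ l))) (𝕀 (b ≡ᵇ n) ℕ.+ succs (c ∷ l))
                               + insertionSum (shift (𝕀 (b <ᵇ c)) (𝕀 (suc b ≡ᵇ c)) h) c l
  insertionSum-∷ h {b} {c} l b≤n c≤n =
    ≡.trans (Σ<-suc (suc (length l)) f)
            (cong (_+ insertionSum (shift (𝕀 (b <ᵇ c)) (𝕀 (suc b ≡ᵇ c)) h) c l) (cong₂ h asc-front suc-front))
    where
    f : ℕ → ℤ
    f j = h (ascents (b ∷ ins j M (c ∷ l))) (succs (b ∷ ins j M (c ∷ l)))
    asc-front : ascents (b ∷ M ∷ c ∷ l) ≡ suc (ascents (c ∷ l))
    asc-front = cong₂ ℕ._+_ (𝕀-< {b} (s≤s b≤n)) (cong (ℕ._+ ascents (c ∷ l)) (𝕀-≥ {M} (ℕP.m≤n⇒m≤1+n c≤n)))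
    suc-front : succs (b ∷ M ∷ c ∷ l) ≡ 𝕀 (b ≡ᵇ n) ℕ.+ succs (c ∷ l)
    suc-front = cong (λ t → 𝕀 (b ≡ᵇ n) ℕ.+ (t ℕ.+ succs (c ∷ l)))
                     (𝕀-≢ {suc M} {c} λ { ≡.refl → ℕP.1+n≰n (ℕP.m≤n⇒m≤1+n c≤n) })

  insertionSum≡spread : ∀ h b l → All (_≤ n) (b ∷ l) →
    insertionSum h b l ≡ spread h (ascents (b ∷ l)) (succs (b ∷ l)) (occurrences n (b ∷ l)) (length l)
  insertionSum≡spread h b []      (b≤n ∷ []) =
    ≡.trans (cong (λ a → h (a ℕ.+ 0) (𝕀 (b ≡ᵇ n) ℕ.+ 0) + + 0) (𝕀-< {b} (s≤s b≤n))) (spread-end (endKind n b≤n) h)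
  insertionSum≡spread h b (c ∷ l) (b≤n ∷ c≤n ∷ l≤n) = begin
    insertionSum h b (c ∷ l)
      ≡⟨ insertionSum-∷ h l b≤n c≤n ⟩
    h (suc (ascents (c ∷ l))) (𝕀 (b ≡ᵇ n) ℕ.+ succs (c ∷ l)) + insertionSum h′ c l
      ≡⟨ cong (_+_ (h (suc (ascents (c ∷ l))) (𝕀 (b ≡ᵇ n) ℕ.+ succs (c ∷ l))))
              (insertionSum≡spread h′ c l (c≤n ∷ l≤n)) ⟩
    h (suc (ascents (c ∷ l))) (𝕀 (b ≡ᵇ n) ℕ.+ succs (c ∷ l))
      + spread h′ (ascents (c ∷ l)) (succs (c ∷ l)) (occurrences n (c ∷ l)) (length l)
      ≡⟨ spread-gap (gapKind n b≤n c≤n) h (ascents (c ∷ l)) (succs (c ∷ l)) (occurrences n (c ∷ l)) (length l) ⟩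
    spread h (ascents (b ∷ c ∷ l)) (succs (b ∷ c ∷ l)) (occurrences n (b ∷ c ∷ l)) (length (c ∷ l)) ∎
    where
    open ≡-Reasoning
    h′ = shift (𝕀 (b <ᵇ c)) (𝕀 (suc b ≡ᵇ c)) h

-- The gap in front of σ₁ follows σ₀ = 0: an ascent that is never a succession.
Σ-ins≡spread : ∀ {n σ} h → IsPerm (suc n) σ →
  Σ< (suc (suc n)) (λ i → h (asc (ins i (suc (suc n)) σ)) (succs (ins i (suc (suc n)) σ)))
    ≡ spread h (asc σ) (succs σ) 1 (suc n)
Σ-ins≡spread {σ = []}       h p with () ← IsPerm.length≡ p
Σ-ins≡spread {σ = zero ∷ _} h p with () ← proj₁ (All.head (IsPerm.letters p))
Σ-ins≡spread {n} {suc c ∷ l} h p = begin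
  Σ< (suc (suc n)) f
    ≡⟨ Σ<-suc (suc n) f ⟩
  f 0 + Σ< (suc n) (f ∘ suc)
    ≡⟨ cong₂ _+_ front (cong (λ L → Σ< (suc L) (f ∘ suc)) (sym len)) ⟩
  h (suc A′) S′ + insertionSum (suc n) (shift 1 0 h) (suc c) l
    ≡⟨ cong (_+_ (h (suc A′) S′)) (insertionSum≡spread (suc n) (shift 1 0 h) (suc c) l (All.map proj₂ (IsPerm.letters p))) ⟩
  h (suc A′) S′ + spread (shift 1 0 h) A′ S′ k′ (length l)
    ≡⟨ spread-gap ascent h A′ S′ k′ (length l) ⟩
  spread h (asc (suc c ∷ l)) S′ k′ (suc (length l))
    ≡⟨ cong₂ (spread h (asc (suc c ∷ l)) S′) (occurrences-unique (IsPerm-max∈ p) (IsPerm.unique p)) (cong suc len) ⟩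
  spread h (asc (suc c ∷ l)) S′ 1 (suc n) ∎
  where
  open ≡-Reasoning
  M = suc (suc n)
  f : ℕ → ℤ
  f i = h (asc (ins i M (suc c ∷ l))) (succs (ins i M (suc c ∷ l)))
  A′ = ascents (suc c ∷ l)
  S′ = succs (suc c ∷ l)
  k′ = occurrences (suc n) (suc c ∷ l)
  len : length l ≡ n
  len = ℕP.suc-injective (IsPerm.length≡ p)
  c<M : suc c < M
  c<M = s≤s (proj₂ (All.head (IsPerm.letters p)))
  front : f 0 ≡ h (suc A′) S′
  front = cong₂ h (cong (λ t → suc (t ℕ.+ A′)) (𝕀-≥ {M} (ℕP.<⇒≤ c<M)))
                  (cong (ℕ._+ S′) (𝕀-≢ {suc M} {suc c} λ eq → ℕP.<⇒≢ (ℕP.m<n⇒m<1+n c<M) (sym eq)))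

𝕀-succession≤𝕀-ascent : ∀ a b → 𝕀 (suc a ≡ᵇ b) ≤ 𝕀 (a <ᵇ b)
𝕀-succession≤𝕀-ascent a b with suc a ℕP.≟ b
... | yes ≡.refl = ℕP.≤-reflexive (≡.trans (𝕀-≡ {suc a} ≡.refl) (sym (𝕀-< {a} (ℕP.n<1+n a))))
... | no 1+a≢b   = ℕP.≤-trans (ℕP.≤-reflexive (𝕀-≢ {suc a} 1+a≢b)) z≤n

succs≤ascents : ∀ w → succs w ≤ ascents w
succs≤ascents []          = z≤n
succs≤ascents (a ∷ [])    = z≤n
succs≤ascents (a ∷ b ∷ w) = ℕP.+-mono-≤ (𝕀-succession≤𝕀-ascent a b) (succs≤ascents (b ∷ w))

succs≤asc : ∀ σ → succs σ ≤ asc σ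
succs≤asc []      = z≤n
succs≤asc (a ∷ σ) = ℕP.≤-trans (succs≤ascents (a ∷ σ)) (ℕP.m≤n+m _ (𝕀 (0 <ᵇ a)))

ascents≤length : ∀ b w → ascents (b ∷ w) ≤ length w
ascents≤length b []      = z≤n
ascents≤length b (c ∷ w) = ℕP.+-mono-≤ (𝕀≤1 (b <ᵇ c)) (ascents≤length c w)
  where 𝕀≤1 : ∀ t → 𝕀 t ≤ 1
        𝕀≤1 true  = ℕP.≤-refl
        𝕀≤1 false = z≤n

asc≤length : ∀ σ → asc σ ≤ length σ
asc≤length = ascents≤length 0

afterInsertion : (ℕ → ℕ → ℕ → ℤ) → ℕ → ℕ → ℕ → ℤ
afterInsertion f p q r = f (suc p) q r + + p * f (pred p) (suc q) (suc r) + + q * f p q (suc r) + + r * f p (suc q) r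

atProfile : ∀ {A : Set} → ℕ → (ℕ → ℕ → ℕ → A) → List ℕ → A
atProfile N f σ = f (succs σ) (asc σ ∸ succs σ) (N ∸ asc σ)

profile-total : ∀ {N a s} → s ≤ a → a ≤ N → s ℕ.+ ((a ∸ s) ℕ.+ ((N ∸ a) ℕ.+ 1)) ≡ suc N
profile-total {N} {a} {s} s≤a a≤N = begin
  s ℕ.+ ((a ∸ s) ℕ.+ ((N ∸ a) ℕ.+ 1))  ≡⟨ ℕP.+-assoc s (a ∸ s) _ ⟨
  s ℕ.+ (a ∸ s) ℕ.+ ((N ∸ a) ℕ.+ 1)    ≡⟨ cong (ℕ._+ ((N ∸ a) ℕ.+ 1)) (ℕP.m+[n∸m]≡n s≤a) ⟩
  a ℕ.+ ((N ∸ a) ℕ.+ 1)                ≡⟨ ℕP.+-assoc a (N ∸ a) 1 ⟨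
  a ℕ.+ (N ∸ a) ℕ.+ 1                  ≡⟨ cong (ℕ._+ 1) (ℕP.m+[n∸m]≡n a≤N) ⟩
  N ℕ.+ 1                              ≡⟨ ℕP.+-comm N 1 ⟩
  suc N                                ∎
  where open ≡-Reasoning

spread-atProfile : ∀ N f {a s} → s ≤ a → a ≤ N →
               spread (λ a s → f s (a ∸ s) (suc N ∸ a)) a s 1 N ≡ afterInsertion f s (a ∸ s) (N ∸ a)
spread-atProfile N f {a} {s} s≤a a≤N = begin
  + 1 * f (suc s) (a ∸ s) (N ∸ a) + + s * f (pred s) (a ∸ pred s) (suc N ∸ a)
    + (+ a - + s) * f s (a ∸ s) (suc N ∸ a) + (+ suc N - + a - + 1) * f s (suc a ∸ s) (N ∸ a)
    ≡⟨ cong₂ _+_ (cong₂ _+_ (cong₂ _+_ (ℤP.*-identityˡ (f (suc s) (a ∸ s) (N ∸ a))) second) third) fourth ⟩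
  afterInsertion f s (a ∸ s) (N ∸ a) ∎
  where
  open ≡-Reasoning
  N+1∸a : suc N ∸ a ≡ suc (N ∸ a)
  N+1∸a = ℕP.+-∸-assoc 1 a≤N
  second : + s * f (pred s) (a ∸ pred s) (suc N ∸ a) ≡ + s * f (pred s) (suc (a ∸ s)) (suc (N ∸ a))
  second = *-pred-cong s λ { ≡.refl → cong₂ (f (pred s)) (ℕP.+-∸-assoc 1 s≤a) N+1∸a }
  third : (+ a - + s) * f s (a ∸ s) (suc N ∸ a) ≡ + (a ∸ s) * f s (a ∸ s) (suc (N ∸ a))
  third = cong₂ _*_ (pos-∸ s≤a) (cong (f s (a ∸ s)) N+1∸a)
  fourth : (+ suc N - + a - + 1) * f s (suc a ∸ s) (N ∸ a) ≡ + (N ∸ a) * f s (suc (a ∸ s)) (N ∸ a)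
  fourth = cong₂ _*_ (≡.trans (drop-one (+ N) (+ a)) (pos-∸ a≤N)) (cong (λ q → f s q (N ∸ a)) (ℕP.+-∸-assoc 1 s≤a))
    where drop-one : ∀ N a → + 1 + N - a - + 1 ≡ N - a
          drop-one = solve-∀

∑-Sym-atProfile : ∀ n f → ∑ (Sym (suc (suc n))) (atProfile (suc (suc n)) f)
                          ≡ ∑ (Sym (suc n)) (atProfile (suc n) (afterInsertion f))
∑-Sym-atProfile n f = ≡.trans (∑-Sym-suc (suc n) (atProfile (suc (suc n)) f)) (∑-cong (Sym (suc n)) λ {σ} σ∈ →
  let p = Equivalence.to (∈-Sym⇔IsPerm (suc n) σ) σ∈ in
  ≡.trans (Σ-ins≡spread (λ a s → f s (a ∸ s) (suc (suc n) ∸ a)) p)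
          (spread-atProfile (suc n) f (succs≤asc σ) (≡.subst (asc σ ≤_) (IsPerm.length≡ p) (asc≤length σ))))

-- A sequence a is read both as the EGF Σ aₙ tⁿ/n! (product _⊛_ and derivative ∂ below) and as the
-- coefficient list of the polynomial Σ aₘ uᵐ.
Seq : Set
Seq = ℕ → ℤ

module ≗-Reasoning = SetoidReasoning (ℕ →-setoid ℤ)

infixl 6 _⊕_
infixl 7 _·_

_⊕_ : Seq → Seq → Seq
(f ⊕ g) n = f n + g n

_·_ : ℤ → Seq → Seq
(c · f) n = c * f n

𝟘 : Seq
𝟘 _ = + 0

𝟙 : Seq
𝟙 zero    = + 1
𝟙 (suc _) = + 0

⊕-congˡ : ∀ f {g h} → g ≗ h → f ⊕ g ≗ f ⊕ h
⊕-congˡ f g≗h n = cong (_+_ (f n)) (g≗h n)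

·-cong : ∀ c {f g} → f ≗ g → c · f ≗ c · g
·-cong c f≗g n = cong (c *_) (f≗g n)

-- Polynomial weights in an auxiliary variable u

infixr 8 u+_∙_ u+_^[_]∙_

u+_∙_ : ℤ → Seq → Seq
(u+ c ∙ s) zero    = c * s 0
(u+ c ∙ s) (suc m) = s m + c * s (suc m)

u+_^[_]∙_ : ℤ → ℕ → Seq → Seq
u+ c ^[ zero  ]∙ s = s
u+ c ^[ suc k ]∙ s = u+ c ∙ u+ c ^[ k ]∙ s

d/du : Seq → Seq
d/du s m = + suc m * s (suc m)

u+-cong : ∀ c {s t} → s ≗ t → u+ c ∙ s ≗ u+ c ∙ t
u+-cong c s≗t zero    = cong (c *_) (s≗t 0)
u+-cong c s≗t (suc m) = cong₂ (λ a b → a + c * b) (s≗t m) (s≗t (suc m))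

u+-comm : ∀ a b s → u+ a ∙ u+ b ∙ s ≗ u+ b ∙ u+ a ∙ s
u+-comm a b s zero          = comm₀ a b (s 0)
  where comm₀ : ∀ a b u → a * (b * u) ≡ b * (a * u)
        comm₀ = solve-∀
u+-comm a b s (suc zero)    = comm₁ a b (s 0) (s 1)
  where comm₁ : ∀ a b u v → b * u + a * (u + b * v) ≡ a * u + b * (u + a * v)
        comm₁ = solve-∀
u+-comm a b s (suc (suc m)) = comm₂ a b (s m) (s (suc m)) (s (suc (suc m)))
  where comm₂ : ∀ a b u v w → u + b * v + a * (v + b * w) ≡ u + a * v + b * (v + a * w)
        comm₂ = solve-∀

u+-⊕ : ∀ c s t → u+ c ∙ (s ⊕ t) ≗ u+ c ∙ s ⊕ u+ c ∙ t
u+-⊕ c s t zero    = ℤP.*-distribˡ-+ c (s 0) (t 0)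
u+-⊕ c s t (suc m) = distrib c (s m) (t m) (s (suc m)) (t (suc m))
  where distrib : ∀ c a b u v → a + b + c * (u + v) ≡ a + c * u + (b + c * v)
        distrib = solve-∀

u+-· : ∀ c k s → u+ c ∙ (k · s) ≗ k · (u+ c ∙ s)
u+-· c k s zero    = pull₀ c k (s 0)
  where pull₀ : ∀ c k a → c * (k * a) ≡ k * (c * a)
        pull₀ = solve-∀
u+-· c k s (suc m) = pull₁ c k (s m) (s (suc m))
  where pull₁ : ∀ c k a b → k * a + c * (k * b) ≡ k * (a + c * b)
        pull₁ = solve-∀

d/du-u+ : ∀ c s → d/du (u+ c ∙ s) ≗ s ⊕ u+ c ∙ d/du s
d/du-u+ c s zero    = leibniz₀ c (s 0) (s 1)
  where leibniz₀ : ∀ c a b → + 1 * (a + c * b) ≡ a + c * (+ 1 * b)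
        leibniz₀ = solve-∀
d/du-u+ c s (suc m) = leibniz₁ (+ m) c (s (suc m)) (s (suc (suc m)))
  where leibniz₁ : ∀ m c a b → (+ 1 + (+ 1 + m)) * (a + c * b) ≡ a + ((+ 1 + m) * a + c * ((+ 1 + (+ 1 + m)) * b))
        leibniz₁ = solve-∀

module _ (c : ℤ) where

  u+^-cong : ∀ k {s t} → s ≗ t → u+ c ^[ k ]∙ s ≗ u+ c ^[ k ]∙ t
  u+^-cong zero    s≗t = s≗t
  u+^-cong (suc k) s≗t = u+-cong c (u+^-cong k s≗t)

  u+^-⊕ : ∀ k s t → u+ c ^[ k ]∙ (s ⊕ t) ≗ u+ c ^[ k ]∙ s ⊕ u+ c ^[ k ]∙ t
  u+^-⊕ zero    s t m = ≡.refl
  u+^-⊕ (suc k) s t m = ≡.trans (u+-cong c (u+^-⊕ k s t) m) (u+-⊕ c (u+ c ^[ k ]∙ s) (u+ c ^[ k ]∙ t) m)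

  u+^-· : ∀ k a s → u+ c ^[ k ]∙ (a · s) ≗ a · u+ c ^[ k ]∙ s
  u+^-· zero    a s m = ≡.refl
  u+^-· (suc k) a s m = ≡.trans (u+-cong c (u+^-· k a s) m) (u+-· c a (u+ c ^[ k ]∙ s) m)

  u+^-𝟘 : ∀ k → u+ c ^[ k ]∙ 𝟘 ≗ 𝟘
  u+^-𝟘 zero    m       = ≡.refl
  u+^-𝟘 (suc k) m       = ≡.trans (u+-cong c (u+^-𝟘 k) m) (u+-𝟘 m)
    where u+-𝟘 : u+ c ∙ 𝟘 ≗ 𝟘
          u+-𝟘 zero    = ℤP.*-zeroʳ c
          u+-𝟘 (suc m) = ≡.trans (ℤP.+-identityˡ (c * + 0)) (ℤP.*-zeroʳ c)

  u+^-comm : ∀ k b s → u+ c ^[ k ]∙ u+ b ∙ s ≗ u+ b ∙ u+ c ^[ k ]∙ s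
  u+^-comm zero    b s m = ≡.refl
  u+^-comm (suc k) b s m = ≡.trans (u+-cong c (u+^-comm k b s) m) (u+-comm c b (u+ c ^[ k ]∙ s) m)

  d/du-u+^ : ∀ k s → d/du (u+ c ^[ k ]∙ s) ≗ + k · u+ c ^[ pred k ]∙ s ⊕ u+ c ^[ k ]∙ d/du s
  d/du-u+^ zero    s m = sym (ℤP.+-identityˡ (d/du s m))
  d/du-u+^ (suc k) s m = begin
    d/du (u+ c ∙ Y) m
      ≡⟨ d/du-u+ c Y m ⟩
    Y m + (u+ c ∙ d/du Y) m
      ≡⟨ cong (_+_ (Y m)) (≡.trans (u+-cong c (d/du-u+^ k s) m) (u+-⊕ c (+ k · u+ c ^[ pred k ]∙ s) (u+ c ^[ k ]∙ d/du s) m)) ⟩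
    Y m + ((u+ c ∙ (+ k · u+ c ^[ pred k ]∙ s)) m + (u+ c ^[ suc k ]∙ d/du s) m)
      ≡⟨ cong (λ v → Y m + (v + (u+ c ^[ suc k ]∙ d/du s) m))
              (≡.trans (u+-· c (+ k) (u+ c ^[ pred k ]∙ s) m) (*-pred-cong k λ { ≡.refl → ≡.refl })) ⟩
    Y m + (+ k * Y m + (u+ c ^[ suc k ]∙ d/du s) m)
      ≡⟨ one-more (+ k) (Y m) _ ⟩
    + suc k * Y m + (u+ c ^[ suc k ]∙ d/du s) m ∎
    where
    open ≡-Reasoning
    Y = u+ c ^[ k ]∙ s
    one-more : ∀ k a b → a + (k * a + b) ≡ (+ 1 + k) * a + b
    one-more = solve-∀

VanishesFrom : ℕ → Seq → Set
VanishesFrom N s = ∀ {m} → N ≤ m → s m ≡ + 0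

u+-vanishesFrom : ∀ c {N s} → VanishesFrom N s → VanishesFrom (suc N) (u+ c ∙ s)
u+-vanishesFrom c s≡0 {suc m} (s≤s N≤m) =
  ≡.trans (cong₂ (λ a b → a + c * b) (s≡0 N≤m) (s≡0 (ℕP.m≤n⇒m≤1+n N≤m)))
          (≡.trans (ℤP.+-identityˡ (c * + 0)) (ℤP.*-zeroʳ c))

u+^-vanishesFrom : ∀ c k {N s} → VanishesFrom N s → VanishesFrom (k ℕ.+ N) (u+ c ^[ k ]∙ s)
u+^-vanishesFrom c zero    s≡0 = s≡0
u+^-vanishesFrom c (suc k) s≡0 = u+-vanishesFrom c (u+^-vanishesFrom c k s≡0)

module _ (x : ℤ) where

  eval : ℕ → Seq → ℤ
  eval N s = Σ< N (λ m → x ^ m * s m)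

  eval-u+ : ∀ c N s → VanishesFrom N s → eval (suc N) (u+ c ∙ s) ≡ (x + c) * eval N s
  eval-u+ c N s s≡0 = begin
    eval (suc N) (u+ c ∙ s)
      ≡⟨ Σ<-suc N (λ m → x ^ m * (u+ c ∙ s) m) ⟩
    + 1 * (c * s 0) + Σ< N (λ m → x ^ suc m * (s m + c * s (suc m)))
      ≡⟨ cong (_+_ (+ 1 * (c * s 0))) (≡.trans (Σ<-cong N (λ {m} _ → split x (x ^ m) c (s m) (s (suc m))))
           (≡.trans (∑-+ (upTo N) _ _) (cong₂ _+_ (∑-*ˡ (upTo N) x _) (∑-*ˡ (upTo N) c _)))) ⟩
    + 1 * (c * s 0) + (x * eval N s + c * Σ< N (λ m → x ^ suc m * s (suc m)))
      ≡⟨ regroup x c (s 0) (eval N s) _ ⟩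
    x * eval N s + c * (+ 1 * s 0 + Σ< N (λ m → x ^ suc m * s (suc m)))
      ≡⟨ cong (λ v → x * eval N s + c * v) (≡.trans (sym (Σ<-suc N (λ m → x ^ m * s m)))
           (≡.trans (Σ<-last N (λ m → x ^ m * s m))
             (≡.trans (cong (_+_ (eval N s)) (≡.trans (cong (x ^ N *_) (s≡0 ℕP.≤-refl)) (ℤP.*-zeroʳ (x ^ N))))
               (ℤP.+-identityʳ (eval N s))))) ⟩
    x * eval N s + c * eval N s
      ≡⟨ ℤP.*-distribʳ-+ (eval N s) x c ⟨
    (x + c) * eval N s ∎
    where
    open ≡-Reasoning
    split : ∀ x xᵐ c a b → x * xᵐ * (a + c * b) ≡ x * (xᵐ * a) + c * (x * xᵐ * b)
    split = solve-∀
    regroup : ∀ x c a e t → + 1 * (c * a) + (x * e + c * t) ≡ x * e + c * (+ 1 * a + t)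
    regroup = solve-∀

  eval-u+^ : ∀ c k N s → VanishesFrom N s → eval (k ℕ.+ N) (u+ c ^[ k ]∙ s) ≡ (x + c) ^ k * eval N s
  eval-u+^ c zero    N s s≡0 = sym (ℤP.*-identityˡ (eval N s))
  eval-u+^ c (suc k) N s s≡0 = begin
    eval (suc (k ℕ.+ N)) (u+ c ∙ u+ c ^[ k ]∙ s)  ≡⟨ eval-u+ c (k ℕ.+ N) _ (u+^-vanishesFrom c k s≡0) ⟩
    (x + c) * eval (k ℕ.+ N) (u+ c ^[ k ]∙ s)    ≡⟨ cong ((x + c) *_) (eval-u+^ c k N s s≡0) ⟩
    (x + c) * ((x + c) ^ k * eval N s)           ≡⟨ ℤP.*-assoc (x + c) _ _ ⟨
    (x + c) ^ suc k * eval N s                   ∎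
    where open ≡-Reasoning

module Weights (c₁ c₂ : ℤ) where

  F : ℕ → ℕ → ℕ → Seq
  F p q r = u+ c₁ ^[ p ]∙ u+ 0ℤ ^[ q ]∙ u+ c₂ ^[ r ]∙ 𝟙

  H : Seq → Seq
  H s = u+ 0ℤ ∙ u+ c₂ ∙ s

  F-suc-q : ∀ p q r → F p (suc q) r ≗ u+ 0ℤ ∙ F p q r
  F-suc-q p q r = u+^-comm c₁ p 0ℤ (u+ 0ℤ ^[ q ]∙ u+ c₂ ^[ r ]∙ 𝟙)

  F-suc-r : ∀ p q r → F p q (suc r) ≗ u+ c₂ ∙ F p q r
  F-suc-r p q r m = ≡.trans (u+^-cong c₁ p (u+^-comm 0ℤ q c₂ (u+ c₂ ^[ r ]∙ 𝟙)) m)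
                           (u+^-comm c₁ p c₂ (u+ 0ℤ ^[ q ]∙ u+ c₂ ^[ r ]∙ 𝟙) m)

  H-F : ∀ p q r → H (F p q r) ≗ F p (suc q) (suc r)
  H-F p q r m = sym (≡.trans (F-suc-q p q (suc r) m) (u+-cong 0ℤ (F-suc-r p q r) m))

  F-deriv : ∀ p q r → d/du (F p q r) ≗ + p · F (pred p) q r ⊕ (+ q · F p (pred q) r ⊕ + r · F p q (pred r))
  F-deriv p q r = begin
    d/du (F p q r)
      ≈⟨ d/du-u+^ c₁ p Q ⟩
    pF ⊕ u+ c₁ ^[ p ]∙ d/du Q
      ≈⟨ ⊕-congˡ pF (u+^-cong c₁ p (d/du-u+^ 0ℤ q R)) ⟩
    pF ⊕ u+ c₁ ^[ p ]∙ (+ q · u+ 0ℤ ^[ pred q ]∙ R ⊕ u+ 0ℤ ^[ q ]∙ d/du R)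
      ≈⟨ ⊕-congˡ pF (λ m → ≡.trans (u+^-⊕ c₁ p _ _ m)
                                   (cong₂ _+_ (u+^-· c₁ p (+ q) _ m) (u+^-cong c₁ p (u+^-cong 0ℤ q d/du-R) m))) ⟩
    pF ⊕ (qF ⊕ u+ c₁ ^[ p ]∙ u+ 0ℤ ^[ q ]∙ (+ r · u+ c₂ ^[ pred r ]∙ 𝟙))
      ≈⟨ ⊕-congˡ pF (⊕-congˡ qF (λ m → ≡.trans (u+^-cong c₁ p (u+^-· 0ℤ q (+ r) _) m) (u+^-· c₁ p (+ r) _ m))) ⟩
    pF ⊕ (qF ⊕ + r · F p q (pred r)) ∎
    where
    open ≗-Reasoning
    pF = + p · F (pred p) q r
    qF = + q · F p (pred q) r
    Q = u+ 0ℤ ^[ q ]∙ u+ c₂ ^[ r ]∙ 𝟙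
    R = u+ c₂ ^[ r ]∙ 𝟙
    d/du-R : d/du R ≗ + r · u+ c₂ ^[ pred r ]∙ 𝟙
    d/du-R m = ≡.trans (d/du-u+^ c₂ r 𝟙 m)
                       (≡.trans (cong (_+_ (+ r * (u+ c₂ ^[ pred r ]∙ 𝟙) m)) d/du-𝟙-term) (ℤP.+-identityʳ _))
      where d/du-𝟙-term : (u+ c₂ ^[ r ]∙ d/du 𝟙) m ≡ + 0
            d/du-𝟙-term = ≡.trans (u+^-cong c₂ r (λ k → ℤP.*-zeroʳ (+ suc k)) m) (u+^-𝟘 c₂ r m)

  H-⊕ : ∀ s t → H (s ⊕ t) ≗ H s ⊕ H t
  H-⊕ s t m = ≡.trans (u+-cong 0ℤ (u+-⊕ c₂ s t) m) (u+-⊕ 0ℤ (u+ c₂ ∙ s) (u+ c₂ ∙ t) m)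

  H-· : ∀ k s → H (k · s) ≗ k · H s
  H-· k s m = ≡.trans (u+-cong 0ℤ (u+-· c₂ k s) m) (u+-· 0ℤ k (u+ c₂ ∙ s) m)

  afterInsertion-F : ∀ p q r m → afterInsertion (λ p q r → F p q r m) p q r ≡ (u+ c₁ ∙ F p q r) m + H (d/du (F p q r)) m
  afterInsertion-F p q r m = begin
    afterInsertion (λ p q r → F p q r m) p q r
      ≡⟨ cong₂ _+_ (cong₂ _+_ (cong (_+_ (F (suc p) q r m)) (cong (+ p *_) (sym (H-F (pred p) q r m))))
                              (*-pred-cong q λ { ≡.refl → sym (H-F p (pred q) r m) }))
                   (*-pred-cong r λ { ≡.refl → sym (H-F p q (pred r) m) }) ⟩
    (u+ c₁ ∙ F p q r) m + + p * H Fp m + + q * H Fq m + + r * H Fr m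
      ≡⟨ ℤP.+-assoc (F (suc p) q r m + + p * H Fp m) _ _ ⟩
    (u+ c₁ ∙ F p q r) m + + p * H Fp m + (+ q * H Fq m + + r * H Fr m)
      ≡⟨ ℤP.+-assoc (F (suc p) q r m) _ _ ⟩
    (u+ c₁ ∙ F p q r) m + (+ p * H Fp m + (+ q * H Fq m + + r * H Fr m))
      ≡⟨ cong (_+_ (F (suc p) q r m)) H∘d/du ⟨
    (u+ c₁ ∙ F p q r) m + H (d/du (F p q r)) m ∎
    where
    open ≡-Reasoning
    Fp = F (pred p) q r
    Fq = F p (pred q) r
    Fr = F p q (pred r)
    H∘d/du : H (d/du (F p q r)) m ≡ + p * H Fp m + (+ q * H Fq m + + r * H Fr m)
    H∘d/du = begin
      H (d/du (F p q r)) m                                 ≡⟨ u+-cong 0ℤ (u+-cong c₂ (F-deriv p q r)) m ⟩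
      H (+ p · Fp ⊕ (+ q · Fq ⊕ + r · Fr)) m              ≡⟨ H-⊕ (+ p · Fp) _ m ⟩
      H (+ p · Fp) m + H (+ q · Fq ⊕ + r · Fr) m          ≡⟨ cong₂ _+_ (H-· (+ p) Fp m) (≡.trans (H-⊕ (+ q · Fq) _ m)
                                                                (cong₂ _+_ (H-· (+ q) Fq m) (H-· (+ r) Fr m))) ⟩
      + p * H Fp m + (+ q * H Fq m + + r * H Fr m)        ∎

  u+⊕H∘d/du : ∀ Y m → (u+ c₁ ∙ Y) m + H (d/du Y) m ≡ + m * Y (pred m) + (c₁ + + m * c₂) * Y m
  u+⊕H∘d/du Y zero          = at-0 c₁ c₂ (Y 0) (Y 1)
    where at-0 : ∀ c₁ c₂ a b → c₁ * a + 0ℤ * (c₂ * (+ 1 * b)) ≡ + 0 * a + (c₁ + + 0 * c₂) * a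
          at-0 = solve-∀
  u+⊕H∘d/du Y (suc zero)    = at-1 c₁ c₂ (Y 0) (Y 1) (Y 2)
    where at-1 : ∀ c₁ c₂ a b d → a + c₁ * b + (c₂ * (+ 1 * b) + 0ℤ * (+ 1 * b + c₂ * (+ 2 * d)))
                                 ≡ + 1 * a + (c₁ + + 1 * c₂) * b
          at-1 = solve-∀
  u+⊕H∘d/du Y (suc (suc k)) = at-suc-suc (+ k) c₁ c₂ (Y (suc k)) (Y (suc (suc k))) (Y (suc (suc (suc k))))
    where at-suc-suc : ∀ k c₁ c₂ a b d → a + c₁ * b + ((+ 1 + k) * a + c₂ * ((+ 1 + (+ 1 + k)) * b)
                                          + 0ℤ * ((+ 1 + (+ 1 + k)) * b + c₂ * ((+ 1 + (+ 1 + (+ 1 + k))) * d)))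
                                        ≡ (+ 1 + (+ 1 + k)) * a + (c₁ + (+ 1 + (+ 1 + k)) * c₂) * b
          at-suc-suc = solve-∀

  F-eval : ∀ x p q r → eval x (p ℕ.+ (q ℕ.+ (r ℕ.+ 1))) (F p q r) ≡ (x + c₁) ^ p * ((x + 0ℤ) ^ q * ((x + c₂) ^ r * + 1))
  F-eval x p q r = begin
    eval x (p ℕ.+ (q ℕ.+ (r ℕ.+ 1))) (F p q r)
      ≡⟨ eval-u+^ x c₁ p _ _ (u+^-vanishesFrom 0ℤ q (u+^-vanishesFrom c₂ r 𝟙-vanishesFrom1)) ⟩
    (x + c₁) ^ p * eval x (q ℕ.+ (r ℕ.+ 1)) (u+ 0ℤ ^[ q ]∙ u+ c₂ ^[ r ]∙ 𝟙)
      ≡⟨ cong ((x + c₁) ^ p *_) (eval-u+^ x 0ℤ q _ _ (u+^-vanishesFrom c₂ r 𝟙-vanishesFrom1)) ⟩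
    (x + c₁) ^ p * ((x + 0ℤ) ^ q * eval x (r ℕ.+ 1) (u+ c₂ ^[ r ]∙ 𝟙))
      ≡⟨ cong (λ t → (x + c₁) ^ p * ((x + 0ℤ) ^ q * t)) (eval-u+^ x c₂ r 1 𝟙 𝟙-vanishesFrom1) ⟩
    (x + c₁) ^ p * ((x + 0ℤ) ^ q * ((x + c₂) ^ r * + 1)) ∎
    where
    open ≡-Reasoning
    𝟙-vanishesFrom1 : VanishesFrom 1 𝟙
    𝟙-vanishesFrom1 (s≤s _) = ≡.refl

-- Exponential generating functions

infixl 7 _⊛_

exp : ℤ → Seq
exp a n = a ^ n

∂ : Seq → Seq
∂ f = f ∘ suc

_⊛_ : Seq → Seq → Seq
(f ⊛ g) n = Σ< (suc n) (λ k → + (n C k) * f k * g (n ∸ k))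

VanishesBelow : ℕ → Seq → Set
VanishesBelow d f = ∀ {n} → n < d → f n ≡ + 0

nC0≡1 : ∀ n → n C 0 ≡ 1
nC0≡1 n = ≡.trans (nCk≡nC[n∸k] {n = n} z≤n) (nCn≡1 n)

⊛-cong : ∀ {f f′ g g′} → f ≗ f′ → g ≗ g′ → f ⊛ g ≗ f′ ⊛ g′
⊛-cong f≗f′ g≗g′ n = ∑-cong (upTo (suc n)) λ {k} _ →
  cong₂ (λ a b → + (n C k) * a * b) (f≗f′ k) (g≗g′ (n ∸ k))

⊛-congˡ : ∀ {f f′} g → f ≗ f′ → f ⊛ g ≗ f′ ⊛ g
⊛-congˡ g f≗f′ = ⊛-cong {g = g} {g} f≗f′ (λ _ → ≡.refl)

⊛-congʳ : ∀ f {g g′} → g ≗ g′ → f ⊛ g ≗ f ⊛ g′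
⊛-congʳ f = ⊛-cong {f} {f} (λ _ → ≡.refl)

⊛-at-0 : ∀ f g → (f ⊛ g) 0 ≡ f 0 * g 0
⊛-at-0 f g = unit-coefficient (f 0) (g 0)
  where unit-coefficient : ∀ a b → + 1 * a * b + + 0 ≡ a * b
        unit-coefficient = solve-∀

C0-term : ∀ n a b → + (n C 0) * a * b ≡ a * b
C0-term n a b = ≡.trans (cong (λ c → + c * a * b) (nC0≡1 n)) (one-* a b)
  where one-* : ∀ a b → + 1 * a * b ≡ a * b
        one-* = solve-∀

-- The only place where binomial coefficients are handled (through Pascal's rule): the ring laws below
-- follow from this Leibniz rule by induction on the index.
∂-⊛ : ∀ f g → ∂ (f ⊛ g) ≗ ∂ f ⊛ g ⊕ f ⊛ ∂ g
∂-⊛ f g n = begin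
  (f ⊛ g) (suc n)                                  ≡⟨ Σ<-suc (suc n) t ⟩
  t 0 + Σ< (suc n) (t ∘ suc)                       ≡⟨ cong₂ _+_ (C0-term (suc n) (f 0) (g (suc n)))
                                                        (≡.trans (Σ<-cong (suc n) (λ {k} _ → pascal k))
                                                                 (∑-+ (upTo (suc n)) u v)) ⟩
  f 0 * g (suc n) + ((∂ f ⊛ g) n + Σ< (suc n) v)   ≡⟨ swap-front (f 0 * g (suc n)) ((∂ f ⊛ g) n) (Σ< (suc n) v) ⟩
  (∂ f ⊛ g) n + (f 0 * g (suc n) + Σ< (suc n) v)   ≡⟨ cong (_+_ ((∂ f ⊛ g) n)) boundary ⟩
  (∂ f ⊛ g) n + (f ⊛ ∂ g) n                        ∎
  where
  open ≡-Reasoning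
  t u v w : ℕ → ℤ
  t k = + (suc n C k) * f k * g (suc n ∸ k)
  u k = + (n C k) * f (suc k) * g (n ∸ k)
  v k = + (n C suc k) * f (suc k) * g (n ∸ k)
  w k = + (n C k) * f k * g (suc (n ∸ k))
  swap-front : ∀ a b c → a + (b + c) ≡ b + (a + c)
  swap-front = solve-∀
  pascal : ∀ k → t (suc k) ≡ u k + v k
  pascal k = begin
    + (suc n C suc k) * f (suc k) * g (n ∸ k)
      ≡⟨ cong (λ c → + c * f (suc k) * g (n ∸ k)) (sym (nCk+nC[k+1]≡[n+1]C[k+1] n k)) ⟩
    + (n C k ℕ.+ n C suc k) * f (suc k) * g (n ∸ k)
      ≡⟨ distrib (+ (n C k)) (+ (n C suc k)) (f (suc k)) (g (n ∸ k)) ⟩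
    u k + v k ∎
    where distrib : ∀ a b x y → (a + b) * x * y ≡ a * x * y + b * x * y
          distrib = solve-∀
  v-last : v n ≡ + 0
  v-last = ≡.trans (cong (λ c → + c * f (suc n) * g (n ∸ n)) (k>n⇒nCk≡0 (ℕP.n<1+n n)))
                   (zero-* (f (suc n)) (g (n ∸ n)))
    where zero-* : ∀ a b → + 0 * a * b ≡ + 0
          zero-* = solve-∀
  boundary : f 0 * g (suc n) + Σ< (suc n) v ≡ (f ⊛ ∂ g) n
  boundary = begin
    f 0 * g (suc n) + Σ< (suc n) v        ≡⟨ cong (_+_ (f 0 * g (suc n))) (≡.trans (Σ<-last n v)
                                               (≡.trans (cong (_+_ (Σ< n v)) v-last) (ℤP.+-identityʳ _))) ⟩
    f 0 * g (suc n) + Σ< n v              ≡⟨ cong₂ _+_ (sym (C0-term n (f 0) (g (suc n))))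
                                               (Σ<-cong n (λ {k} k<n → cong (λ m → + (n C suc k) * f (suc k) * g m)
                                                 (ℕP.+-∸-assoc 1 k<n))) ⟩
    w 0 + Σ< n (w ∘ suc)                  ≡⟨ sym (Σ<-suc n w) ⟩
    (f ⊛ ∂ g) n                           ∎

⊛-distribʳ-⊕ : ∀ f g h → (f ⊕ g) ⊛ h ≗ f ⊛ h ⊕ g ⊛ h
⊛-distribʳ-⊕ f g h n = ≡.trans (∑-cong (upTo (suc n)) λ {k} _ → distrib (+ (n C k)) (f k) (g k) (h (n ∸ k)))
                                (∑-+ (upTo (suc n)) (λ k → + (n C k) * f k * h (n ∸ k)) (λ k → + (n C k) * g k * h (n ∸ k)))
  where distrib : ∀ c a b d → c * (a + b) * d ≡ c * a * d + c * b * d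
        distrib = solve-∀

⊛-distribˡ-⊕ : ∀ f g h → f ⊛ (g ⊕ h) ≗ f ⊛ g ⊕ f ⊛ h
⊛-distribˡ-⊕ f g h n = ≡.trans (∑-cong (upTo (suc n)) λ {k} _ → distrib (+ (n C k)) (f k) (g (n ∸ k)) (h (n ∸ k)))
                                (∑-+ (upTo (suc n)) (λ k → + (n C k) * f k * g (n ∸ k)) (λ k → + (n C k) * f k * h (n ∸ k)))
  where distrib : ∀ c a b d → c * a * (b + d) ≡ c * a * b + c * a * d
        distrib = solve-∀

·-⊛ : ∀ c f g → c · f ⊛ g ≗ c · (f ⊛ g)
·-⊛ c f g n = ≡.trans (∑-cong (upTo (suc n)) λ {k} _ → pull (+ (n C k)) c (f k) (g (n ∸ k)))
                       (∑-*ˡ (upTo (suc n)) c (λ k → + (n C k) * f k * g (n ∸ k)))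
  where pull : ∀ e c a b → e * (c * a) * b ≡ c * (e * a * b)
        pull = solve-∀

⊛-· : ∀ c f g → f ⊛ (c · g) ≗ c · (f ⊛ g)
⊛-· c f g n = ≡.trans (∑-cong (upTo (suc n)) λ {k} _ → pull (+ (n C k)) c (f k) (g (n ∸ k)))
                       (∑-*ˡ (upTo (suc n)) c (λ k → + (n C k) * f k * g (n ∸ k)))
  where pull : ∀ e c a b → e * a * (c * b) ≡ c * (e * a * b)
        pull = solve-∀

⊛-vanishesBelow : ∀ {a b f g} → VanishesBelow a f → VanishesBelow b g → VanishesBelow (a ℕ.+ b) (f ⊛ g)
⊛-vanishesBelow {a} {b} {f} {g} f≡0 g≡0 {n} n<a+b = ∑-zero (upTo (suc n)) term≡0
  where
  term≡0 : ∀ {k} → k ∈ upTo (suc n) → + (n C k) * f k * g (n ∸ k) ≡ + 0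
  term≡0 {k} k∈ with k ℕP.<? a
  ... | yes k<a = ≡.trans (cong (λ v → + (n C k) * v * g (n ∸ k)) (f≡0 k<a)) (zero-middle (+ (n C k)) (g (n ∸ k)))
    where zero-middle : ∀ c d → c * + 0 * d ≡ + 0
          zero-middle = solve-∀
  ... | no k≮a = ≡.trans (cong (_*_ (+ (n C k) * f k)) (g≡0 n∸k<b)) (ℤP.*-zeroʳ (+ (n C k) * f k))
    where
    a≤k = ℕP.≮⇒≥ k≮a
    n∸k<b : n ∸ k < b
    n∸k<b = ℕP.≤-<-trans (ℕP.∸-monoʳ-≤ n a≤k)
              (≡.subst (n ∸ a <_) (ℕP.m+n∸m≡n a b)
                (ℕP.∸-monoˡ-< n<a+b (ℕP.≤-trans a≤k (ℕP.≤-pred (∈-upTo⁻ k∈)))))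

⊛-zeroˡ : ∀ f → 𝟘 ⊛ f ≗ 𝟘
⊛-zeroˡ f n = ∑-zero (upTo (suc n)) λ {k} _ → zero-middle (+ (n C k)) (f (n ∸ k))
  where zero-middle : ∀ c d → c * + 0 * d ≡ + 0
        zero-middle = solve-∀

⊛-comm : ∀ f g → f ⊛ g ≗ g ⊛ f
⊛-comm f g zero    = ≡.trans (⊛-at-0 f g) (≡.trans (ℤP.*-comm (f 0) (g 0)) (sym (⊛-at-0 g f)))
⊛-comm f g (suc n) = begin
  (f ⊛ g) (suc n)                  ≡⟨ ∂-⊛ f g n ⟩
  (∂ f ⊛ g) n + (f ⊛ ∂ g) n        ≡⟨ cong₂ _+_ (⊛-comm (∂ f) g n) (⊛-comm f (∂ g) n) ⟩
  (g ⊛ ∂ f) n + (∂ g ⊛ f) n        ≡⟨ ℤP.+-comm ((g ⊛ ∂ f) n) _ ⟩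
  (∂ g ⊛ f) n + (g ⊛ ∂ f) n        ≡⟨ sym (∂-⊛ g f n) ⟩
  (g ⊛ f) (suc n)                  ∎
  where open ≡-Reasoning

⊛-assoc : ∀ f g h → (f ⊛ g) ⊛ h ≗ f ⊛ (g ⊛ h)
⊛-assoc f g h zero    = begin
  ((f ⊛ g) ⊛ h) 0          ≡⟨ ≡.trans (⊛-at-0 (f ⊛ g) h) (cong (_* h 0) (⊛-at-0 f g)) ⟩
  f 0 * g 0 * h 0          ≡⟨ ℤP.*-assoc (f 0) (g 0) (h 0) ⟩
  f 0 * (g 0 * h 0)        ≡⟨ sym (≡.trans (⊛-at-0 f (g ⊛ h)) (cong (f 0 *_) (⊛-at-0 g h))) ⟩
  (f ⊛ (g ⊛ h)) 0          ∎
  where open ≡-Reasoning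
⊛-assoc f g h (suc n) = begin
  ((f ⊛ g) ⊛ h) (suc n)
    ≡⟨ ∂-⊛ (f ⊛ g) h n ⟩
  (∂ (f ⊛ g) ⊛ h) n + ((f ⊛ g) ⊛ ∂ h) n
    ≡⟨ cong (_+ ((f ⊛ g) ⊛ ∂ h) n) (≡.trans (⊛-congˡ h (∂-⊛ f g) n) (⊛-distribʳ-⊕ (∂ f ⊛ g) (f ⊛ ∂ g) h n)) ⟩
  ((∂ f ⊛ g) ⊛ h) n + ((f ⊛ ∂ g) ⊛ h) n + ((f ⊛ g) ⊛ ∂ h) n
    ≡⟨ cong₂ _+_ (cong₂ _+_ (⊛-assoc (∂ f) g h n) (⊛-assoc f (∂ g) h n)) (⊛-assoc f g (∂ h) n) ⟩
  (∂ f ⊛ (g ⊛ h)) n + (f ⊛ (∂ g ⊛ h)) n + (f ⊛ (g ⊛ ∂ h)) n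
    ≡⟨ ℤP.+-assoc ((∂ f ⊛ (g ⊛ h)) n) _ _ ⟩
  (∂ f ⊛ (g ⊛ h)) n + ((f ⊛ (∂ g ⊛ h)) n + (f ⊛ (g ⊛ ∂ h)) n)
    ≡⟨ cong (_+_ ((∂ f ⊛ (g ⊛ h)) n)) (sym (≡.trans (⊛-congʳ f (∂-⊛ g h) n) (⊛-distribˡ-⊕ f (∂ g ⊛ h) (g ⊛ ∂ h) n))) ⟩
  (∂ f ⊛ (g ⊛ h)) n + (f ⊛ ∂ (g ⊛ h)) n
    ≡⟨ sym (∂-⊛ f (g ⊛ h) n) ⟩
  (f ⊛ (g ⊛ h)) (suc n) ∎
  where open ≡-Reasoning

⊛-identityˡ : ∀ f → 𝟙 ⊛ f ≗ f
⊛-identityˡ f zero    = ≡.trans (⊛-at-0 𝟙 f) (ℤP.*-identityˡ (f 0))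
⊛-identityˡ f (suc n) = begin
  (𝟙 ⊛ f) (suc n)                ≡⟨ ∂-⊛ 𝟙 f n ⟩
  (𝟘 ⊛ f) n + (𝟙 ⊛ ∂ f) n        ≡⟨ cong₂ _+_ (⊛-zeroˡ f n) (⊛-identityˡ (∂ f) n) ⟩
  + 0 + f (suc n)                ≡⟨ ℤP.+-identityˡ (f (suc n)) ⟩
  f (suc n)                      ∎
  where open ≡-Reasoning

⊛-identityʳ : ∀ f → f ⊛ 𝟙 ≗ f
⊛-identityʳ f n = ≡.trans (⊛-comm f 𝟙 n) (⊛-identityˡ f n)

exp-⊛ : ∀ a b → exp a ⊛ exp b ≗ exp (a + b)
exp-⊛ a b zero    = ⊛-at-0 (exp a) (exp b)
exp-⊛ a b (suc n) = begin
  (exp a ⊛ exp b) (suc n)                        ≡⟨ ∂-⊛ (exp a) (exp b) n ⟩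
  (a · exp a ⊛ exp b) n + (exp a ⊛ (b · exp b)) n ≡⟨ cong₂ _+_ (·-⊛ a (exp a) (exp b) n) (⊛-· b (exp a) (exp b) n) ⟩
  a * (exp a ⊛ exp b) n + b * (exp a ⊛ exp b) n  ≡⟨ cong (λ v → a * v + b * v) (exp-⊛ a b n) ⟩
  a * (a + b) ^ n + b * (a + b) ^ n              ≡⟨ sym (ℤP.*-distribʳ-+ ((a + b) ^ n) a b) ⟩
  (a + b) ^ suc n                                ∎
  where open ≡-Reasoning

LocallyFinite : ℕ → (ℕ → Seq) → Set
LocallyFinite d A = ∀ {m n} → d ℕ.+ n ≤ m → A m n ≡ + 0

-- The sum of the whole family A: under LocallyFinite d A only m < d + n contribute to coefficient n.
Σ∞ : ℕ → (ℕ → Seq) → Seq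
Σ∞ d A n = Σ< (d ℕ.+ n) (λ m → A m n)

Σ∞-⊛ : ∀ d A Y → LocallyFinite d A → Σ∞ d A ⊛ Y ≗ Σ∞ d (λ m → A m ⊛ Y)
Σ∞-⊛ d A Y finite n = begin
  Σ< (suc n) (λ k → + (n C k) * Σ< (d ℕ.+ k) (λ m → A m k) * Y (n ∸ k))
    ≡⟨ Σ<-cong (suc n) (λ {k} k<1+n → cong (λ s → + (n C k) * s * Y (n ∸ k)) (pad (ℕP.≤-pred k<1+n))) ⟩
  Σ< (suc n) (λ k → + (n C k) * Σ< (d ℕ.+ n) (λ m → A m k) * Y (n ∸ k))
    ≡⟨ Σ<-cong (suc n) (λ {k} _ → pull-inside (+ (n C k)) (Y (n ∸ k)) (λ m → A m k)) ⟩
  Σ< (suc n) (λ k → Σ< (d ℕ.+ n) (λ m → + (n C k) * A m k * Y (n ∸ k)))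
    ≡⟨ ∑-swap (upTo (suc n)) (upTo (d ℕ.+ n)) _ ⟩
  Σ< (d ℕ.+ n) (λ m → (A m ⊛ Y) n) ∎
  where
  open ≡-Reasoning
  pad : ∀ {k} → k ≤ n → Σ< (d ℕ.+ k) (λ m → A m k) ≡ Σ< (d ℕ.+ n) (λ m → A m k)
  pad {k} k≤n = sym (≡.trans (cong (λ N → Σ< N (λ m → A m k)) d+n≡d+k+[n∸k])
                             (Σ<-pad (d ℕ.+ k) (n ∸ k) (λ m → A m k) finite))
    where d+n≡d+k+[n∸k] : d ℕ.+ n ≡ d ℕ.+ k ℕ.+ (n ∸ k)
          d+n≡d+k+[n∸k] = ≡.trans (cong (d ℕ.+_) (sym (ℕP.m+[n∸m]≡n k≤n))) (sym (ℕP.+-assoc d k (n ∸ k)))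
  pull-inside : ∀ c y (f : ℕ → ℤ) → c * Σ< (d ℕ.+ n) f * y ≡ Σ< (d ℕ.+ n) (λ m → c * f m * y)
  pull-inside c y f = sym (≡.trans (∑-*ʳ (upTo (d ℕ.+ n)) y (λ m → c * f m)) (cong (_* y) (∑-*ˡ (upTo (d ℕ.+ n)) c f)))

⊛-zeroʳ : ∀ f → f ⊛ 𝟘 ≗ 𝟘
⊛-zeroʳ f n = ≡.trans (⊛-comm f 𝟘 n) (⊛-zeroˡ f n)

⊛-swapʳ : ∀ f g h → (f ⊛ g) ⊛ h ≗ (f ⊛ h) ⊛ g
⊛-swapʳ f g h n = begin
  ((f ⊛ g) ⊛ h) n    ≡⟨ ⊛-assoc f g h n ⟩
  (f ⊛ (g ⊛ h)) n    ≡⟨ ⊛-congʳ f (⊛-comm g h) n ⟩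
  (f ⊛ (h ⊛ g)) n    ≡⟨ sym (⊛-assoc f h g n) ⟩
  ((f ⊛ h) ⊛ g) n    ∎
  where open ≡-Reasoning

Σ∞-·-⊛ : ∀ d (a : ℕ → ℤ) (F : ℕ → Seq) (Y : Seq) → LocallyFinite d (λ m → a m · F m) →
         ∀ n → (Σ∞ d (λ m → a m · F m) ⊛ Y) n ≡ Σ< (d ℕ.+ n) (λ m → a m * (F m ⊛ Y) n)
Σ∞-·-⊛ d a F Y finite n = ≡.trans (Σ∞-⊛ d (λ m → a m · F m) Y finite n)
                                  (Σ<-cong (d ℕ.+ n) {λ m → (a m · F m ⊛ Y) n} {λ m → a m * (F m ⊛ Y) n}
                                    (λ {m} _ → ·-⊛ (a m) (F m) Y n))

⊕·-⊛ : ∀ f a g h → (f ⊕ a · g) ⊛ h ≗ f ⊛ h ⊕ a · (g ⊛ h)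
⊕·-⊛ f a g h n = ≡.trans (⊛-distribʳ-⊕ f (a · g) h n) (cong (_+_ ((f ⊛ h) n)) (·-⊛ a g h n))

⊛-⊕· : ∀ h f a g → h ⊛ (f ⊕ a · g) ≗ h ⊛ f ⊕ a · (h ⊛ g)
⊛-⊕· h f a g n = ≡.trans (⊛-distribˡ-⊕ h f (a · g) n) (cong (_+_ ((h ⊛ f) n)) (⊛-· a h g n))

-- Solving the insertion recurrence

module ExponentialSolution (c₁ c₂ : ℤ) where

  -- The EGF (e^(c₂t) - 1)/c₂.
  B : Seq
  B zero    = + 0
  B (suc j) = c₂ ^ j

  ∂B : ∂ B ≗ 𝟙 ⊕ c₂ · B
  ∂B zero    = sym (cong (_+_ (+ 1)) (ℤP.*-zeroʳ c₂))
  ∂B (suc j) = sym (ℤP.+-identityˡ _)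

  B^ : ℕ → Seq
  B^ zero    = 𝟙
  B^ (suc k) = B^ k ⊛ B

  B^-vanishesBelow : ∀ k → VanishesBelow k (B^ k)
  B^-vanishesBelow zero    ()
  B^-vanishesBelow (suc k) {n} n<1+k = ⊛-vanishesBelow {k} {1} {B^ k} {B}
    (B^-vanishesBelow k) (λ { (s≤s z≤n) → ≡.refl }) (≡.subst (n <_) (ℕP.+-comm 1 k) n<1+k)

  ∂-B^ : ∀ k → ∂ (B^ (suc k)) ≗ + suc k · (B^ k ⊛ ∂ B)
  ∂-B^ zero    n = begin
    (𝟙 ⊛ B) (suc n)               ≡⟨ ∂-⊛ 𝟙 B n ⟩
    (𝟘 ⊛ B) n + (𝟙 ⊛ ∂ B) n       ≡⟨ cong (_+ (𝟙 ⊛ ∂ B) n) (⊛-zeroˡ B n) ⟩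
    + 0 + (𝟙 ⊛ ∂ B) n             ≡⟨ ℤP.+-identityˡ _ ⟩
    (𝟙 ⊛ ∂ B) n                   ≡⟨ sym (ℤP.*-identityˡ _) ⟩
    + 1 * (𝟙 ⊛ ∂ B) n             ∎
    where open ≡-Reasoning
  ∂-B^ (suc k) n = begin
    (B^ (suc k) ⊛ B) (suc n)
      ≡⟨ ∂-⊛ (B^ (suc k)) B n ⟩
    (∂ (B^ (suc k)) ⊛ B) n + (B^ (suc k) ⊛ ∂ B) n
      ≡⟨ cong (_+ (B^ (suc k) ⊛ ∂ B) n) (≡.trans (⊛-congˡ B (∂-B^ k) n) (·-⊛ (+ suc k) (B^ k ⊛ ∂ B) B n)) ⟩
    + suc k * ((B^ k ⊛ ∂ B) ⊛ B) n + (B^ (suc k) ⊛ ∂ B) n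
      ≡⟨ cong (λ v → + suc k * v + (B^ (suc k) ⊛ ∂ B) n) (⊛-swapʳ (B^ k) (∂ B) B n) ⟩
    + suc k * (B^ (suc k) ⊛ ∂ B) n + (B^ (suc k) ⊛ ∂ B) n
      ≡⟨ one-more (+ k) ((B^ (suc k) ⊛ ∂ B) n) ⟩
    + suc (suc k) * (B^ (suc k) ⊛ ∂ B) n ∎
    where
    open ≡-Reasoning
    one-more : ∀ k v → (+ 1 + k) * v + v ≡ (+ 1 + (+ 1 + k)) * v
    one-more = solve-∀

  B^⊛∂B : ∀ j → B^ j ⊛ ∂ B ≗ B^ j ⊕ c₂ · B^ (suc j)
  B^⊛∂B j n = ≡.trans (⊛-congʳ (B^ j) ∂B n)
    (≡.trans (⊛-⊕· (B^ j) 𝟙 c₂ B n) (cong (_+ c₂ * B^ (suc j) n) (⊛-identityʳ (B^ j) n)))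

  X : Seq
  X = exp (c₁ + c₂)

  X⊛B^-vanishesBelow : ∀ k → VanishesBelow k (X ⊛ B^ k)
  X⊛B^-vanishesBelow k = ⊛-vanishesBelow {0} {k} {X} (λ ()) (B^-vanishesBelow k)

  ∂-X⊛B^ : ∀ k → ∂ (X ⊛ B^ k) ≗ (c₁ + c₂ + + k * c₂) · (X ⊛ B^ k) ⊕ + k · (X ⊛ B^ (pred k))
  ∂-X⊛B^ k n = begin
    (X ⊛ B^ k) (suc n)                                   ≡⟨ ∂-⊛ X (B^ k) n ⟩
    ((c₁ + c₂) · X ⊛ B^ k) n + (X ⊛ ∂ (B^ k)) n          ≡⟨ cong₂ _+_ (·-⊛ (c₁ + c₂) X (B^ k) n) (X⊛∂B^ k) ⟩
    (c₁ + c₂) * (X ⊛ B^ k) n + + k * ((X ⊛ B^ (pred k)) n + c₂ * (X ⊛ B^ k) n)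
                                                         ≡⟨ regroup (c₁ + c₂) c₂ (+ k) ((X ⊛ B^ k) n) ((X ⊛ B^ (pred k)) n) ⟩
    (c₁ + c₂ + + k * c₂) * (X ⊛ B^ k) n + + k * (X ⊛ B^ (pred k)) n ∎
    where
    open ≡-Reasoning
    regroup : ∀ a c k u v → a * u + k * (v + c * u) ≡ (a + k * c) * u + k * v
    regroup = solve-∀
    X⊛∂B^ : ∀ k → (X ⊛ ∂ (B^ k)) n ≡ + k * ((X ⊛ B^ (pred k)) n + c₂ * (X ⊛ B^ k) n)
    X⊛∂B^ zero    = ≡.trans (⊛-zeroʳ X n) (sym (ℤP.*-zeroˡ ((X ⊛ B^ 0) n + c₂ * (X ⊛ B^ 0) n)))
    X⊛∂B^ (suc j) = begin
      (X ⊛ ∂ (B^ (suc j))) n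
        ≡⟨ ≡.trans (⊛-congʳ X (∂-B^ j) n) (⊛-· (+ suc j) X (B^ j ⊛ ∂ B) n) ⟩
      + suc j * (X ⊛ (B^ j ⊛ ∂ B)) n
        ≡⟨ cong (+ suc j *_) (≡.trans (⊛-congʳ X (B^⊛∂B j) n) (⊛-⊕· X (B^ j) c₂ (B^ (suc j)) n)) ⟩
      + suc j * ((X ⊛ B^ j) n + c₂ * (X ⊛ B^ (suc j)) n) ∎

  G : ℕ → Seq
  G m = + m · (X ⊛ B^ (pred m))

  ∂-G : ∀ m → ∂ (G m) ≗ + m · G (pred m) ⊕ (c₁ + + m * c₂) · G m
  ∂-G zero    n = zero-case c₁ c₂ ((X ⊛ B^ 0) (suc n)) ((X ⊛ B^ 0) n)
    where zero-case : ∀ c₁ c₂ a b → + 0 * a ≡ + 0 * (+ 0 * b) + (c₁ + + 0 * c₂) * (+ 0 * b)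
          zero-case = solve-∀
  ∂-G (suc k) n = ≡.trans (cong (+ suc k *_) (∂-X⊛B^ k n))
    (regroup c₁ c₂ (+ k) ((X ⊛ B^ k) n) ((X ⊛ B^ (pred k)) n))
    where regroup : ∀ c₁ c₂ k a b → (+ 1 + k) * ((c₁ + c₂ + k * c₂) * a + k * b)
                                   ≡ (+ 1 + k) * (k * b) + (c₁ + (+ 1 + k) * c₂) * ((+ 1 + k) * a)
          regroup = solve-∀

  G-vanishesBelow : ∀ m → VanishesBelow (pred m) (G m)
  G-vanishesBelow m n<m-1 = ≡.trans (cong (+ m *_) (X⊛B^-vanishesBelow (pred m) n<m-1)) (ℤP.*-zeroʳ (+ m))

  module _ (x : ℤ) where

    V : Seq
    V = 𝟙 ⊕ (- x) · B

    ⊛V : ∀ f → f ⊛ V ≗ f ⊕ (- x) · (f ⊛ B)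
    ⊛V f n = ≡.trans (⊛-⊕· f 𝟙 (- x) B n) (cong (_+ - x * (f ⊛ B) n) (⊛-identityʳ f n))

    J : Seq
    J = Σ∞ 1 (λ k → (x ^ k) · B^ k)

    J-finite : LocallyFinite 1 (λ k → (x ^ k) · B^ k)
    J-finite {k} 1+n≤k = ≡.trans (cong (x ^ k *_) (B^-vanishesBelow k 1+n≤k)) (ℤP.*-zeroʳ (x ^ k))

    J⊛V : J ⊛ V ≗ 𝟙
    J⊛V n = begin
      (J ⊛ V) n
        ≡⟨ ⊛V J n ⟩
      J n + - x * (J ⊛ B) n
        ≡⟨ cong (λ v → J n + - x * v) (Σ∞-·-⊛ 1 (x ^_) B^ B J-finite n) ⟩
      Σ< (suc n) t + - x * Σ< (suc n) t′
        ≡⟨ cong (_+_ (Σ< (suc n) t)) (sym (∑-*ˡ (upTo (suc n)) (- x) t′)) ⟩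
      Σ< (suc n) t + Σ< (suc n) (λ k → - x * t′ k)
        ≡⟨ sym (∑-+ (upTo (suc n)) t (λ k → - x * t′ k)) ⟩
      Σ< (suc n) (λ k → t k + - x * t′ k)
        ≡⟨ Σ<-cong (suc n) (λ {k} _ → absorb x (x ^ k) (t k) (B^ (suc k) n)) ⟩
      Σ< (suc n) (λ k → t k - t (suc k))
        ≡⟨ Σ<-telescope (suc n) t ⟩
      t 0 - t (suc n)
        ≡⟨ cong₂ _-_ (ℤP.*-identityˡ (𝟙 n)) (J-finite {suc n} {n} ℕP.≤-refl) ⟩
      𝟙 n - + 0
        ≡⟨ ℤP.+-identityʳ (𝟙 n) ⟩
      𝟙 n ∎
      where
      open ≡-Reasoning
      t t′ : ℕ → ℤ
      t k = x ^ k * B^ k n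
      t′ k = x ^ k * B^ (suc k) n
      absorb : ∀ x xᵏ a b → a + - x * (xᵏ * b) ≡ a - x * xᵏ * b
      absorb = solve-∀

    Ω : Seq
    Ω = Σ∞ 2 (λ m → (x ^ m) · G m)

    Ω-finite : LocallyFinite 2 (λ m → (x ^ m) · G m)
    Ω-finite {suc m} (s≤s 1+n≤m) = ≡.trans (cong (x ^ suc m *_) (G-vanishesBelow (suc m) 1+n≤m)) (ℤP.*-zeroʳ (x ^ suc m))

    X⊛J : ∀ n → (X ⊛ J) n ≡ Σ< (suc n) (λ k → x ^ k * (X ⊛ B^ k) n)
    X⊛J n = ≡.trans (⊛-comm X J n) (≡.trans (Σ∞-·-⊛ 1 (x ^_) B^ X J-finite n)
              (Σ<-cong (suc n) (λ {k} _ → cong (x ^ k *_) (⊛-comm (B^ k) X n))))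

    x^k·G⊛V : ∀ k n → x ^ suc k * (G (suc k) ⊛ V) n
                      ≡ + suc k * (x ^ suc k * (X ⊛ B^ k) n - x ^ suc (suc k) * (X ⊛ B^ (suc k)) n)
    x^k·G⊛V k n = begin
      x ^ suc k * (G (suc k) ⊛ V) n                          ≡⟨ cong (x ^ suc k *_) (·-⊛ (+ suc k) (X ⊛ B^ k) V n) ⟩
      x ^ suc k * (+ suc k * (X ⊛ B^ k ⊛ V) n)               ≡⟨ cong (λ v → x ^ suc k * (+ suc k * v)) (⊛V (X ⊛ B^ k) n) ⟩
      x ^ suc k * (+ suc k * ((X ⊛ B^ k) n + - x * (X ⊛ B^ k ⊛ B) n))
                                                             ≡⟨ cong (λ v → x ^ suc k * (+ suc k * ((X ⊛ B^ k) n + - x * v)))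
                                                                     (⊛-assoc X (B^ k) B n) ⟩
      x ^ suc k * (+ suc k * ((X ⊛ B^ k) n + - x * (X ⊛ B^ (suc k)) n))
                                                             ≡⟨ regroup (+ k) x (x ^ k) ((X ⊛ B^ k) n) ((X ⊛ B^ (suc k)) n) ⟩
      + suc k * (x ^ suc k * (X ⊛ B^ k) n - x ^ suc (suc k) * (X ⊛ B^ (suc k)) n) ∎
      where
      open ≡-Reasoning
      regroup : ∀ k x xᵏ u v → x * xᵏ * ((+ 1 + k) * (u + - x * v)) ≡ (+ 1 + k) * (x * xᵏ * u - x * (x * xᵏ) * v)
      regroup = solve-∀

    Ω⊛V : Ω ⊛ V ≗ x · (X ⊛ J)
    Ω⊛V n = begin
      (Ω ⊛ V) n
        ≡⟨ Σ∞-·-⊛ 2 (x ^_) G V Ω-finite n ⟩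
      Σ< (2 ℕ.+ n) (λ m → x ^ m * (G m ⊛ V) n)
        ≡⟨ Σ<-suc (suc n) (λ m → x ^ m * (G m ⊛ V) n) ⟩
      + 1 * (G 0 ⊛ V) n + Σ< (suc n) (λ k → x ^ suc k * (G (suc k) ⊛ V) n)
        ≡⟨ cong₂ _+_ (≡.trans (cong (+ 1 *_) (·-⊛ (+ 0) (X ⊛ 𝟙) V n)) (zero-term ((X ⊛ 𝟙 ⊛ V) n)))
                     (Σ<-cong (suc n) (λ {k} _ → x^k·G⊛V k n)) ⟩
      + 0 + Σ< (suc n) (λ k → + suc k * (b k - b (suc k)))
        ≡⟨ ≡.trans (ℤP.+-identityˡ _) (Σ<-weighted-telescope (suc n) b) ⟩
      Σ< (suc n) b - + suc n * b (suc n)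
        ≡⟨ cong (λ v → Σ< (suc n) b - + suc n * (x ^ suc (suc n) * v)) (X⊛B^-vanishesBelow (suc n) ℕP.≤-refl) ⟩
      Σ< (suc n) b - + suc n * (x ^ suc (suc n) * + 0)
        ≡⟨ drop-zero (Σ< (suc n) b) (+ suc n) (x ^ suc (suc n)) ⟩
      Σ< (suc n) b
        ≡⟨ ≡.trans (Σ<-cong (suc n) (λ {k} _ → ℤP.*-assoc x (x ^ k) (a k)))
                   (∑-*ˡ (upTo (suc n)) x (λ k → x ^ k * a k)) ⟩
      x * Σ< (suc n) (λ k → x ^ k * a k)
        ≡⟨ cong (x *_) (X⊛J n) ⟨
      x * (X ⊛ J) n ∎
      where
      open ≡-Reasoning
      a b : ℕ → ℤ
      a k = (X ⊛ B^ k) n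
      b k = x ^ suc k * a k
      zero-term : ∀ v → + 1 * (+ 0 * v) ≡ + 0
      zero-term = solve-∀
      drop-zero : ∀ s k p → s - k * (p * + 0) ≡ s
      drop-zero = solve-∀

    Ω⊛V⊛V : Ω ⊛ V ⊛ V ≗ x · X
    Ω⊛V⊛V = begin
      Ω ⊛ V ⊛ V          ≈⟨ ⊛-congˡ V Ω⊛V ⟩
      x · (X ⊛ J) ⊛ V    ≈⟨ ·-⊛ x (X ⊛ J) V ⟩
      x · (X ⊛ J ⊛ V)    ≈⟨ (λ n → cong (x *_) (≡.trans (⊛-assoc X J V n) (⊛-congʳ X J⊛V n))) ⟩
      x · (X ⊛ 𝟙)        ≈⟨ (λ n → cong (x *_) (⊛-identityʳ X n)) ⟩
      x · X              ∎
      where open ≗-Reasoning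

    Eₓ : Seq
    Eₓ = exp x ⊕ (- x) · exp (+ 1)

    D≗Eₓ⊛Eₓ : D x ≗ Eₓ ⊛ Eₓ
    D≗Eₓ⊛Eₓ n = sym (begin
      (Eₓ ⊛ Eₓ) n
        ≡⟨ ⊕·-⊛ (exp x) (- x) (exp (+ 1)) Eₓ n ⟩
      (exp x ⊛ Eₓ) n + - x * (exp (+ 1) ⊛ Eₓ) n
        ≡⟨ cong₂ (λ u v → u + - x * v) (⊛-⊕· (exp x) (exp x) (- x) (exp (+ 1)) n)
                                       (⊛-⊕· (exp (+ 1)) (exp x) (- x) (exp (+ 1)) n) ⟩
      (exp x ⊛ exp x) n + - x * (exp x ⊛ exp (+ 1)) n + - x * ((exp (+ 1) ⊛ exp x) n + - x * (exp (+ 1) ⊛ exp (+ 1)) n)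
        ≡⟨ cong₂ (λ u v → u + - x * v) (cong₂ (λ u v → u + - x * v) (exp-⊛ x x n) (exp-⊛ x (+ 1) n))
                                       (cong₂ (λ u v → u + - x * v) (exp-⊛ (+ 1) x n) (exp-⊛ (+ 1) (+ 1) n)) ⟩
      (x + x) ^ n + - x * (x + + 1) ^ n + - x * ((+ 1 + x) ^ n + - x * (+ 2) ^ n)
        ≡⟨ cong₂ (λ u v → u ^ n + - x * (x + + 1) ^ n + - x * (v ^ n + - x * (+ 2) ^ n)) (double x) (ℤP.+-comm (+ 1) x) ⟩
      (+ 2 * x) ^ n + - x * (x + + 1) ^ n + - x * ((x + + 1) ^ n + - x * (+ 2) ^ n)
        ≡⟨ collect ((+ 2 * x) ^ n) ((x + + 1) ^ n) ((+ 2) ^ n) x ⟩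
      D x n ∎)
      where
      open ≡-Reasoning
      double : ∀ x → x + x ≡ + 2 * x
      double = solve-∀
      collect : ∀ a b c x → a + - x * b + - x * (b + - x * c) ≡ a - + 2 * x * b + x * x * c
      collect = solve-∀

    module _ (c₂≡1-x : c₂ ≡ + 1 - x) where

      c₂·V : c₂ · V ≗ 𝟙 ⊕ (- x) · exp c₂
      c₂·V zero    = ≡.trans (cong (_* (+ 1 + - x * + 0)) c₂≡1-x) (at-0 x)
        where at-0 : ∀ x → (+ 1 - x) * (+ 1 + - x * + 0) ≡ + 1 + - x * + 1
              at-0 = solve-∀
      c₂·V (suc j) = at-suc c₂ x (c₂ ^ j)
        where at-suc : ∀ c x p → c * (+ 0 + - x * p) ≡ + 0 + - x * (c * p)
              at-suc = solve-∀

      Eₓ≗c₂·exp⊛V : Eₓ ≗ c₂ · (exp x ⊛ V)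
      Eₓ≗c₂·exp⊛V n = sym (begin
        c₂ * (exp x ⊛ V) n                          ≡⟨ ⊛-· c₂ (exp x) V n ⟨
        (exp x ⊛ (c₂ · V)) n                        ≡⟨ ⊛-congʳ (exp x) c₂·V n ⟩
        (exp x ⊛ (𝟙 ⊕ (- x) · exp c₂)) n            ≡⟨ ⊛-distribˡ-⊕ (exp x) 𝟙 ((- x) · exp c₂) n ⟩
        (exp x ⊛ 𝟙) n + (exp x ⊛ ((- x) · exp c₂)) n
                                                    ≡⟨ cong₂ _+_ (⊛-identityʳ (exp x) n) (⊛-· (- x) (exp x) (exp c₂) n) ⟩
        x ^ n + - x * (exp x ⊛ exp c₂) n            ≡⟨ cong (λ v → x ^ n + - x * v) (exp-⊛ x c₂ n) ⟩
        x ^ n + - x * (x + c₂) ^ n                  ≡⟨ cong (λ c → x ^ n + - x * c ^ n) x+c₂≡1 ⟩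
        Eₓ n                                        ∎)
        where
        open ≡-Reasoning
        x+c₂≡1 : x + c₂ ≡ + 1
        x+c₂≡1 = ≡.trans (cong (_+_ x) c₂≡1-x) (cancel x)
          where cancel : ∀ x → x + (+ 1 - x) ≡ + 1
                cancel = solve-∀

      ⊛Eₓ : ∀ f → f ⊛ Eₓ ≗ c₂ · (f ⊛ V ⊛ exp x)
      ⊛Eₓ f = begin
        f ⊛ Eₓ                   ≈⟨ ⊛-congʳ f Eₓ≗c₂·exp⊛V ⟩
        f ⊛ (c₂ · (exp x ⊛ V))   ≈⟨ ⊛-· c₂ f (exp x ⊛ V) ⟩
        c₂ · (f ⊛ (exp x ⊛ V))   ≈⟨ ·-cong c₂ (λ n → ≡.trans (sym (⊛-assoc f (exp x) V n)) (⊛-swapʳ f (exp x) V n)) ⟩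
        c₂ · (f ⊛ V ⊛ exp x)     ∎
        where open ≗-Reasoning

      Ω⊛D : Ω ⊛ D x ≗ (c₂ * c₂ * x) · exp (c₁ + c₂ + x + x)
      Ω⊛D = begin
        Ω ⊛ D x                                  ≈⟨ ⊛-congʳ Ω D≗Eₓ⊛Eₓ ⟩
        Ω ⊛ (Eₓ ⊛ Eₓ)                            ≈⟨ ⊛-assoc Ω Eₓ Eₓ ⟨
        Ω ⊛ Eₓ ⊛ Eₓ                              ≈⟨ ⊛Eₓ (Ω ⊛ Eₓ) ⟩
        c₂ · (Ω ⊛ Eₓ ⊛ V ⊛ exp x)                ≈⟨ ·-cong c₂ (⊛-congˡ (exp x) (⊛-congˡ V (⊛Eₓ Ω))) ⟩
        c₂ · (c₂ · (Ω ⊛ V ⊛ exp x) ⊛ V ⊛ exp x)  ≈⟨ ·-cong c₂ (λ n → ≡.trans (⊛-congˡ (exp x) (·-⊛ c₂ (Ω ⊛ V ⊛ exp x) V) n)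
                                                                          (·-⊛ c₂ (Ω ⊛ V ⊛ exp x ⊛ V) (exp x) n)) ⟩
        c₂ · (c₂ · (Ω ⊛ V ⊛ exp x ⊛ V ⊛ exp x))  ≈⟨ ·-cong c₂ (·-cong c₂ (⊛-congˡ (exp x) (⊛-swapʳ (Ω ⊛ V) (exp x) V))) ⟩
        c₂ · (c₂ · (Ω ⊛ V ⊛ V ⊛ exp x ⊛ exp x))  ≈⟨ ·-cong c₂ (·-cong c₂ (⊛-congˡ (exp x) (⊛-congˡ (exp x) Ω⊛V⊛V))) ⟩
        c₂ · (c₂ · (x · X ⊛ exp x ⊛ exp x))      ≈⟨ ·-cong c₂ (·-cong c₂ x·X⊛exp⊛exp) ⟩
        c₂ · (c₂ · (x · exp (c₁ + c₂ + x + x)))  ≈⟨ (λ n → reassoc c₂ x ((c₁ + c₂ + x + x) ^ n)) ⟩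
        (c₂ * c₂ * x) · exp (c₁ + c₂ + x + x)    ∎
        where
        open ≗-Reasoning
        reassoc : ∀ c x e → c * (c * (x * e)) ≡ c * c * x * e
        reassoc = solve-∀
        x·X⊛exp⊛exp : x · X ⊛ exp x ⊛ exp x ≗ x · exp (c₁ + c₂ + x + x)
        x·X⊛exp⊛exp n = ≡.trans (⊛-congˡ (exp x) (·-⊛ x X (exp x)) n) (≡.trans (·-⊛ x (X ⊛ exp x) (exp x) n)
          (cong (x *_) (≡.trans (⊛-congˡ (exp x) (exp-⊛ (c₁ + c₂) x) n) (exp-⊛ (c₁ + c₂ + x) x n))))

^-distribʳ-* : ∀ a b n → (a * b) ^ n ≡ a ^ n * b ^ n
^-distribʳ-* a b zero    = ≡.refl
^-distribʳ-* a b (suc n) = ≡.trans (cong (a * b *_) (^-distribʳ-* a b n)) (interchange a b (a ^ n) (b ^ n))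
  where interchange : ∀ a b c d → a * b * (c * d) ≡ a * c * (b * d)
        interchange = solve-∀

module _ (x z : ℤ) where

  c₁ c₂ : ℤ
  c₁ = x * z - x
  c₂ = + 1 - x

  x+c₁≡xz : x + c₁ ≡ x * z
  x+c₁≡xz = cancel x z
    where cancel : ∀ x z → x + (x * z - x) ≡ x * z
          cancel = solve-∀

  x+c₂≡1 : x + c₂ ≡ + 1
  x+c₂≡1 = cancel x
    where cancel : ∀ x → x + (+ 1 - x) ≡ + 1
          cancel = solve-∀

  open Weights c₁ c₂
  open ExponentialSolution c₁ c₂

  F[_] : ℕ → ℕ → ℕ → ℕ → ℤ
  F[ m ] p q r = F p q r m

  E : ℕ → ℕ → ℤ
  E N m = ∑ (Sym N) (atProfile N F[ m ])

  E-suc : ∀ n m → E (suc (suc n)) m ≡ + m * E (suc n) (pred m) + (c₁ + + m * c₂) * E (suc n) m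
  E-suc n m = begin
    E (suc (suc n)) m
      ≡⟨ ∑-Sym-atProfile n F[ m ] ⟩
    ∑ (Sym (suc n)) (atProfile (suc n) (afterInsertion F[ m ]))
      ≡⟨ ∑-cong (Sym (suc n)) (λ {σ} _ → ≡.trans (afterInsertion-F (succs σ) (asc σ ∸ succs σ) (suc n ∸ asc σ) m)
                                                   (u+⊕H∘d/du (F (succs σ) (asc σ ∸ succs σ) (suc n ∸ asc σ)) m)) ⟩
    ∑ (Sym (suc n)) (λ σ → + m * atProfile (suc n) F[ pred m ] σ + (c₁ + + m * c₂) * atProfile (suc n) F[ m ] σ)
      ≡⟨ ∑-+ (Sym (suc n)) _ _ ⟩
    ∑ (Sym (suc n)) (λ σ → + m * atProfile (suc n) F[ pred m ] σ)
      + ∑ (Sym (suc n)) (λ σ → (c₁ + + m * c₂) * atProfile (suc n) F[ m ] σ)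
      ≡⟨ cong₂ _+_ (∑-*ˡ (Sym (suc n)) (+ m) _) (∑-*ˡ (Sym (suc n)) (c₁ + + m * c₂) _) ⟩
    + m * E (suc n) (pred m) + (c₁ + + m * c₂) * E (suc n) m ∎
    where open ≡-Reasoning

  E≡G : ∀ n m → E (suc n) m ≡ G m n
  E≡G zero    zero          = ≡.refl
  E≡G zero    (suc zero)    = ≡.refl
  E≡G zero    (suc (suc j)) = sym (G-vanishesBelow (suc (suc j)) (s≤s z≤n))
  E≡G (suc n) m = begin
    E (suc (suc n)) m                                          ≡⟨ E-suc n m ⟩
    + m * E (suc n) (pred m) + (c₁ + + m * c₂) * E (suc n) m   ≡⟨ cong₂ (λ u v → + m * u + (c₁ + + m * c₂) * v)
                                                                        (E≡G n (pred m)) (E≡G n m) ⟩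
    + m * G (pred m) n + (c₁ + + m * c₂) * G m n               ≡⟨ ∂-G m n ⟨
    G m (suc n)                                                ∎
    where open ≡-Reasoning

  monomial≡eval : ∀ n σ → IsPerm (suc n) σ → x ^ asc σ * z ^ succs σ ≡ eval x (2 ℕ.+ n) (atProfile (suc n) F σ)
  monomial≡eval n σ p = sym (begin
    eval x (2 ℕ.+ n) (F s (a ∸ s) (suc n ∸ a))
      ≡⟨ cong (λ N → eval x N (F s (a ∸ s) (suc n ∸ a))) (sym (profile-total s≤a a≤n+1)) ⟩
    eval x (s ℕ.+ ((a ∸ s) ℕ.+ ((suc n ∸ a) ℕ.+ 1))) (F s (a ∸ s) (suc n ∸ a))
      ≡⟨ F-eval x s (a ∸ s) (suc n ∸ a) ⟩
    (x + c₁) ^ s * ((x + 0ℤ) ^ (a ∸ s) * ((x + c₂) ^ (suc n ∸ a) * + 1))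
      ≡⟨ cong₂ (λ u v → u ^ s * v) x+c₁≡xz
               (cong₂ (λ u w → u ^ (a ∸ s) * (w ^ (suc n ∸ a) * + 1)) (ℤP.+-identityʳ x) x+c₂≡1) ⟩
    (x * z) ^ s * (x ^ (a ∸ s) * ((+ 1) ^ (suc n ∸ a) * + 1))
      ≡⟨ cong₂ (λ u v → u * (x ^ (a ∸ s) * (v * + 1))) (^-distribʳ-* x z s) (ℤP.^-zeroˡ (suc n ∸ a)) ⟩
    x ^ s * z ^ s * (x ^ (a ∸ s) * (+ 1 * + 1))
      ≡⟨ regroup (x ^ s) (z ^ s) (x ^ (a ∸ s)) ⟩
    x ^ s * x ^ (a ∸ s) * z ^ s
      ≡⟨ cong (_* z ^ s) (ℤP.^-distribˡ-+-* x s (a ∸ s)) ⟨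
    x ^ (s ℕ.+ (a ∸ s)) * z ^ s
      ≡⟨ cong (λ k → x ^ k * z ^ s) (ℕP.m+[n∸m]≡n s≤a) ⟩
    x ^ a * z ^ s ∎)
    where
    open ≡-Reasoning
    a = asc σ
    s = succs σ
    s≤a = succs≤asc σ
    a≤n+1 = ≡.subst (a ≤_) (IsPerm.length≡ p) (asc≤length σ)
    regroup : ∀ a b c → a * b * (c * (+ 1 * + 1)) ≡ a * c * b
    regroup = solve-∀

  P≡Ω : ∀ n → P (suc n) x z ≡ Ω x n
  P≡Ω n = begin
    ∑ (Sym (suc n)) (λ σ → x ^ asc σ * z ^ succs σ)
      ≡⟨ ∑-cong (Sym (suc n)) (λ {σ} σ∈ → monomial≡eval n σ (Equivalence.to (∈-Sym⇔IsPerm (suc n) σ) σ∈)) ⟩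
    ∑ (Sym (suc n)) (λ σ → Σ< (2 ℕ.+ n) (λ m → x ^ m * atProfile (suc n) F[ m ] σ))
      ≡⟨ ∑-swap (Sym (suc n)) (upTo (2 ℕ.+ n)) _ ⟩
    Σ< (2 ℕ.+ n) (λ m → ∑ (Sym (suc n)) (λ σ → x ^ m * atProfile (suc n) F[ m ] σ))
      ≡⟨ Σ<-cong (2 ℕ.+ n) (λ {m} _ → ≡.trans (∑-*ˡ (Sym (suc n)) (x ^ m) _) (cong (x ^ m *_) (E≡G n m))) ⟩
    Ω x n ∎
    where open ≡-Reasoning

corollary3p3 : (x z : ℤ) (n : ℕ) → lhsCoeff x z n ≡ rhsCoeff x z n
corollary3p3 x z n = begin
  lhsCoeff x z n                          ≡⟨ ⊛-congˡ (D x) (P≡Ω x z) n ⟩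
  (Ω x ⊛ D x) n                           ≡⟨ Ω⊛D x ≡.refl n ⟩
  b * b * x * (a + b + x + x) ^ n         ≡⟨ cong (λ t → b * b * x * t ^ n) (exponent x z) ⟩
  b * b * x * (x * z + + 1) ^ n           ≡⟨ reorder b x ((x * z + + 1) ^ n) ⟩
  rhsCoeff x z n                          ∎
  where
  open ≡-Reasoning
  a = c₁ x z
  b = c₂ x z
  open ExponentialSolution a b
  exponent : ∀ x z → x * z - x + (+ 1 - x) + x + x ≡ x * z + + 1
  exponent = solve-∀
  reorder : ∀ c x e → c * c * x * e ≡ x * (c * (c * + 1)) * e
  reorder = solve-∀
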